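{- Let $TILE$ and $ILL$ be the index sets defined below. Then $TILE \equiv_m ILL$, i.e. $TILE \leq_m ILL$ and $ILL \leq_m TILE$.
   Context: $\varphi_e$ denotes the $e$-th partial computable function $\omega\to\omega$. For $A,B\subseteq\omega$, $A\leq_m B$ means there is a total computable $f:\omega\to\omega$ with $x\in A\iff f(x)\in B$ for all $x$. A Wang prototile is a 4-tuple $\langle l,u,r,b\rangle$ of colours (natural numbers), read as a unit square diagonally quadrisected with colours on its left, upper, right and bottom quarters; a set of Wang prototiles is identified with the set of codes (natural numbers) of its 4-tuples. Given a set $S$ of Wang prototiles, a total $S$-tiling of the plane is a function $f:\mathbb{Z}^2\to S$ such that for all $(x,y)$ the right colour of $f(x,y)$ equals the left colour of $f(x+1,y)$ and the upper colour of $f(x,y)$ equals the bottom colour of $f(x,y+1)$ (tiles are only translated, never rotated). $TILE=\{e:\varphi_e$ is the characteristic function of an infinite set $S$ of Wang prototiles which has a total $S$-tiling of the plane$\}$. Finite strings of natural numbers ($\omega^{<\omega}$) are coded by natural numbers; a tree is a subset of $\omega^{<\omega}$ closed under initial segments; it is ill-founded if it has an infinite path. $ILL=\{e:\varphi_e$ is the characteristic function of an ill-founded tree $T\subseteq\omega^{<\omega}\}$. -}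

module Defs where

open import Data.Nat using (ℕ; zero; suc; _+_; _≤_; _<_)
open import Data.Integer as ℤ using (ℤ)
import Data.Fin as F
open F using (Fin)
open import Data.Vec using (Vec; []; _∷_; lookup)
open import Data.List using (List; []; _∷_; _++_; map; upTo)
open import Data.Product using (Σ; _×_; _,_; proj₁; proj₂)
open import Data.Sum using (_⊎_)
open import Relation.Binary.PropositionalEquality using (_≡_)

tri : ℕ → ℕ
tri zero    = zero
tri (suc k) = suc k + tri k

pair : ℕ → ℕ → ℕ
pair a b = tri (a + b) + b

nextP : ℕ × ℕ → ℕ × ℕ
nextP (zero  , b) = (suc b , zero)
nextP (suc a , b) = (a , suc b)

-- inverse of pair
unpair : ℕ → ℕ × ℕ
unpair zero    = (zero , zero)
unpair (suc n) = nextP (unpair n)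

data PR : ℕ → Set where
  Z : ∀ {n} → PR n
  S : PR 1
  P : ∀ {n} → Fin n → PR n
  C : ∀ {m n} → PR m → Vec (PR n) m → PR n
  R : ∀ {n} → PR n → PR (suc (suc n)) → PR (suc n)
  M : ∀ {n} → PR (suc n) → PR n

mutual
  data Eval : ∀ {n} → PR n → Vec ℕ n → ℕ → Set where
    evZ  : ∀ {n} {xs : Vec ℕ n} → Eval Z xs zero
    evS  : ∀ {x} → Eval S (x ∷ []) (suc x)
    evP  : ∀ {n} {i : Fin n} {xs} → Eval (P i) xs (lookup xs i)
    evC  : ∀ {m n} {f : PR m} {gs : Vec (PR n) m} {xs ys z} →
           EvalVec gs xs ys → Eval f ys z → Eval (C f gs) xs z
    evR0 : ∀ {n} {g : PR n} {h xs z} →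
           Eval g xs z → Eval (R g h) (zero ∷ xs) z
    evRS : ∀ {n} {g : PR n} {h xs k z w} →
           Eval (R g h) (k ∷ xs) z → Eval h (k ∷ z ∷ xs) w →
           Eval (R g h) (suc k ∷ xs) w
    evM  : ∀ {n} {f : PR (suc n)} {xs y} →
           Eval f (y ∷ xs) zero →
           (∀ z → z < y → Σ ℕ λ v → Eval f (z ∷ xs) (suc v)) →
           Eval (M f) xs y

  data EvalVec : ∀ {n m} → Vec (PR n) m → Vec ℕ n → Vec ℕ m → Set where
    []  : ∀ {n} {xs : Vec ℕ n} → EvalVec [] xs []
    _∷_ : ∀ {n m} {g : PR n} {gs : Vec (PR n) m} {xs y ys} →
          Eval g xs y → EvalVec gs xs ys → EvalVec (g ∷ gs) xs (y ∷ ys)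

clampFin : (n : ℕ) → ℕ → Fin (suc n)
clampFin n       zero    = F.zero
clampFin zero    (suc b) = F.zero
clampFin (suc n) (suc b) = F.suc (clampFin n b)

mutual
  -- first argument is fuel
  dec : ℕ → (n : ℕ) → ℕ → PR n
  dec zero    n e       = Z
  dec (suc f) n zero    = Z
  dec (suc f) n (suc k) = decTag f n (proj₁ (unpair k)) (proj₂ (unpair k))

  decTag : ℕ → (n : ℕ) → ℕ → ℕ → PR n
  decTag f n       0 b = Z
  decTag f (suc zero) 1 b = S
  decTag f n       1 b = Z
  decTag f zero    2 b = Z
  decTag f (suc n) 2 b = P (clampFin n b)
  decTag f n       3 b =
    C (dec f (proj₁ (unpair b)) (proj₁ (unpair (proj₂ (unpair b)))))
      (decVec f n (proj₁ (unpair b)) (proj₂ (unpair (proj₂ (unpair b)))))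
  decTag f zero    4 b = Z
  decTag f (suc n) 4 b = R (dec f n (proj₁ (unpair b))) (dec f (suc (suc n)) (proj₂ (unpair b)))
  decTag f n       5 b = M (dec f (suc n) b)
  decTag f n       _ b = Z

  decVec : ℕ → (n m : ℕ) → ℕ → Vec (PR n) m
  decVec f n zero    c = []
  decVec f n (suc m) c = dec f n (proj₁ (unpair c)) ∷ decVec f n m (proj₂ (unpair c))

code : ℕ → PR 1
code e = dec (suc e) 1 e

φ : ℕ → ℕ → ℕ → Set
φ e x y = Eval (code e) (x ∷ []) y

TotalComputable : (ℕ → ℕ) → Set
TotalComputable f = Σ ℕ λ e → ∀ x → φ e x (f x)

_⇔_ : Set → Set → Set
A ⇔ B = (A → B) × (B → A)

_≤m_ : (ℕ → Set) → (ℕ → Set) → Set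
A ≤m B = Σ (ℕ → ℕ) λ f → TotalComputable f × (∀ x → A x ⇔ B (f x))

_≡m_ : (ℕ → Set) → (ℕ → Set) → Set
A ≡m B = (A ≤m B) × (B ≤m A)

-- φ_e is the characteristic function of some set (total, 0/1-valued);
-- the set is then { x | φ e x 1 }
IsCharFn : ℕ → Set
IsCharFn e = ∀ x → φ e x 0 ⊎ φ e x 1

InSet : ℕ → ℕ → Set
InSet e x = φ e x 1

Infinite : (ℕ → Set) → Set
Infinite A = ∀ n → Σ ℕ λ m → n ≤ m × A m

record Tile : Set where
  constructor ⟨_,_,_,_⟩
  field
    left up right bottom : ℕ
open Tile public

tileCode : Tile → ℕ
tileCode t = pair (left t) (pair (up t) (pair (right t) (bottom t)))

Tiling : (Tile → Set) → Set
Tiling Ts = Σ (ℤ → ℤ → Tile) λ f →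
  (∀ x y → Ts (f x y)) ×
  (∀ x y → right (f x y) ≡ left (f (x ℤ.+ ℤ.1ℤ) y)) ×
  (∀ x y → up (f x y) ≡ bottom (f x (y ℤ.+ ℤ.1ℤ)))

TILE : ℕ → Set
TILE e = IsCharFn e × Infinite (InSet e) × Tiling (λ t → InSet e (tileCode t))

strCode : List ℕ → ℕ
strCode []      = zero
strCode (a ∷ s) = suc (pair a (strCode s))

IsTree : (List ℕ → Set) → Set
IsTree T = ∀ s t → T (s ++ t) → T s

IllFounded : (List ℕ → Set) → Set
IllFounded T = Σ (ℕ → ℕ) λ p → ∀ n → T (map p (upTo n))

ILL : ℕ → Set
ILL e = IsCharFn e × IsTree (λ s → InSet e (strCode s))
                   × IllFounded (λ s → InSet e (strCode s))

-- Both reductions send e to the index of a program that on input x lists φ_e(0), …, φ_e(x) and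
-- then runs a primitive recursive test on x and the listing. The test answers 2 when a guard fails
-- (φ_e(x) ∉ {0, 1}, or, for ILL ≤ TILE, x is in the tree but its parent is not), so the new index
-- is a characteristic function exactly when e satisfies the guard everywhere.
--
-- TILE ≤ ILL: enumerate ℤ² by ℕ and let the tree consist of the sequences whose i-th entry places a
-- tile of S on the i-th cell, matching the neighbours placed so far, together with an element of S
-- that is at least i. Infinite paths are tilings of the plane together with witnesses that S is
-- infinite.
--
-- ILL ≤ TILE: all tiles have left and right colour 0, so the columns of a tiling are independent.
-- The vertical colours carry strings that shrink to [] below a unique turning tile and grow along
-- nodes of T above it, so a column exists iff T has an infinite branch, and it then uses
-- infinitely many tiles.

module Submission where

open import Defs
open import Data.Empty using (⊥; ⊥-elim)
open import Data.Unit using (⊤; tt)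
open import Data.Product using (_×_; Σ; _,_; proj₁; proj₂)
open import Data.Sum using (_⊎_; inj₁; inj₂)
open import Data.Nat as N using (ℕ; zero; suc; _+_; _∸_; _≤_; _<_; z≤n; s≤s)
open import Data.Nat.Properties
open import Data.Integer as ℤ using (ℤ; +_; -[1+_])
import Data.Integer.Properties as ℤ
import Data.Fin as F
open F using (Fin; #_)
open import Data.Vec as V using (Vec; []; _∷_; lookup; tabulate)
open import Data.Vec.Properties using (tabulate∘lookup; tabulate-∘)
open import Data.List as L using (List; []; _∷_; _++_; _∷ʳ_)
open import Data.List.Properties using (length-++; map-++; upTo-∷ʳ; map-upTo; length-map; length-upTo; ++-identityʳ; ++-assoc)
open import Function using (_∘_)
open import Relation.Binary.PropositionalEquality
open import Relation.Binary.Definitions using (tri<; tri≈; tri>)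

unpair₁ unpair₂ : ℕ → ℕ
unpair₁ n = proj₁ (unpair n)
unpair₂ n = proj₂ (unpair n)

n≤tri : ∀ n → n ≤ tri n
n≤tri zero    = z≤n
n≤tri (suc n) = m≤m+n (suc n) (tri n)

tri-mono-≤ : ∀ {m n} → m ≤ n → tri m ≤ tri n
tri-mono-≤ {zero}  _         = z≤n
tri-mono-≤ {suc m} (s≤s m≤n) = +-mono-≤ (s≤s m≤n) (tri-mono-≤ m≤n)

unpair-tri+ : ∀ s b → b ≤ s → unpair (tri s + b) ≡ (s ∸ b , b)
unpair-tri+ zero    zero    _ = refl
unpair-tri+ (suc s) zero    _ = begin
  unpair (suc s + tri s + 0)  ≡⟨ cong (λ n → nextP (unpair n)) (trans (+-identityʳ (s + tri s)) (+-comm s (tri s))) ⟩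
  nextP (unpair (tri s + s))  ≡⟨ cong nextP (unpair-tri+ s s ≤-refl) ⟩
  nextP (s ∸ s , s)           ≡⟨ cong (λ a → nextP (a , s)) (n∸n≡0 s) ⟩
  (suc s , 0)                 ∎
  where open ≡-Reasoning
unpair-tri+ (suc s) (suc b) (s≤s b≤s) = begin
  unpair (tri (suc s) + suc b)  ≡⟨ cong unpair (+-suc (tri (suc s)) b) ⟩
  nextP (unpair (tri (suc s) + b))  ≡⟨ cong nextP (unpair-tri+ (suc s) b (m≤n⇒m≤1+n b≤s)) ⟩
  nextP (suc s ∸ b , b)         ≡⟨ cong (λ a → nextP (a , b)) (+-∸-assoc 1 b≤s) ⟩
  (s ∸ b , suc b)               ∎
  where open ≡-Reasoning

unpair-pair : ∀ a b → unpair (pair a b) ≡ (a , b)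
unpair-pair a b = trans (unpair-tri+ (a + b) b (m≤n+m b a)) (cong (_, b) (m+n∸n≡m a b))

unpair₁-pair : ∀ a b → unpair₁ (pair a b) ≡ a
unpair₁-pair a b = cong proj₁ (unpair-pair a b)

unpair₂-pair : ∀ a b → unpair₂ (pair a b) ≡ b
unpair₂-pair a b = cong proj₂ (unpair-pair a b)

pair-nextP : ∀ p → pair (proj₁ (nextP p)) (proj₂ (nextP p)) ≡ suc (pair (proj₁ p) (proj₂ p))
pair-nextP (zero , b) rewrite +-identityʳ b | +-identityʳ (b + tri b) = cong suc (+-comm b (tri b))
pair-nextP (suc a , b) = trans (cong (λ s → tri s + suc b) (+-suc a b)) (+-suc (tri (suc (a + b))) b)

pair-unpair : ∀ n → pair (unpair₁ n) (unpair₂ n) ≡ n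
pair-unpair zero    = refl
pair-unpair (suc n) = trans (pair-nextP (unpair n)) (cong suc (pair-unpair n))

pair-injective : ∀ {a b c d} → pair a b ≡ pair c d → a ≡ c × b ≡ d
pair-injective {a} {b} {c} {d} eq =
  trans (sym (unpair₁-pair a b)) (trans (cong unpair₁ eq) (unpair₁-pair c d)) ,
  trans (sym (unpair₂-pair a b)) (trans (cong unpair₂ eq) (unpair₂-pair c d))

pair-surjective : ∀ c {a b} → unpair₁ c ≡ a → unpair₂ c ≡ b → c ≡ pair a b
pair-surjective c eq₁ eq₂ = trans (sym (pair-unpair c)) (cong₂ pair eq₁ eq₂)

m≤pair[m,n] : ∀ m n → m ≤ pair m n
m≤pair[m,n] m n = ≤-trans (m≤m+n m n) (≤-trans (n≤tri (m + n)) (m≤m+n (tri (m + n)) n))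

n≤pair[m,n] : ∀ m n → n ≤ pair m n
n≤pair[m,n] m n = m≤n+m n (tri (m + n))

pair[m,n]<o⇒m<o : ∀ m n {o} → pair m n < o → m < o
pair[m,n]<o⇒m<o m n = ≤-<-trans (m≤pair[m,n] m n)

pair[m,n]<o⇒n<o : ∀ m n {o} → pair m n < o → n < o
pair[m,n]<o⇒n<o m n = ≤-<-trans (n≤pair[m,n] m n)

pair-monoʳ-< : ∀ a {b c} → b < c → pair a b < pair a c
pair-monoʳ-< a b<c = +-mono-≤-< (tri-mono-≤ (+-monoʳ-≤ a (<⇒≤ b<c))) b<c

unpair₁≤ : ∀ n → unpair₁ n ≤ n
unpair₁≤ n = subst (unpair₁ n ≤_) (pair-unpair n) (m≤pair[m,n] (unpair₁ n) (unpair₂ n))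

unpair₂≤ : ∀ n → unpair₂ n ≤ n
unpair₂≤ n = subst (unpair₂ n ≤_) (pair-unpair n) (n≤pair[m,n] (unpair₁ n) (unpair₂ n))

strCode-injective : ∀ {s t} → strCode s ≡ strCode t → s ≡ t
strCode-injective {[]}    {[]}    eq = refl
strCode-injective {a ∷ s} {b ∷ t} eq with pair-injective (suc-injective eq)
... | a≡b , s≡t = cong₂ _∷_ a≡b (strCode-injective s≡t)

strCode-surjective : ∀ c → Σ (List ℕ) λ s → strCode s ≡ c
strCode-surjective c = go c c ≤-refl
  where
  go : ∀ fuel c → c ≤ fuel → Σ (List ℕ) λ s → strCode s ≡ c
  go _          zero    _         = [] , refl
  go (suc fuel) (suc k) (s≤s k≤f) with go fuel (unpair₂ k) (≤-trans (unpair₂≤ k) k≤f)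
  ... | s , eq = unpair₁ k ∷ s , cong suc (trans (cong (pair (unpair₁ k)) eq) (pair-unpair k))

length≤strCode : ∀ s → L.length s ≤ strCode s
length≤strCode []      = z≤n
length≤strCode (a ∷ s) = s≤s (≤-trans (length≤strCode s) (n≤pair[m,n] a (strCode s)))

strCode-∷ʳ-> : ∀ s a → strCode s < strCode (s ∷ʳ a)
strCode-∷ʳ-> []      a = s≤s z≤n
strCode-∷ʳ-> (b ∷ s) a = s≤s (pair-monoʳ-< b (strCode-∷ʳ-> s a))

decodeStr : ℕ → List ℕ
decodeStr c = proj₁ (strCode-surjective c)

strCode-decodeStr : ∀ c → strCode (decodeStr c) ≡ c
strCode-decodeStr c = proj₂ (strCode-surjective c)

decodeStr-strCode : ∀ s → decodeStr (strCode s) ≡ s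
decodeStr-strCode s = strCode-injective (strCode-decodeStr (strCode s))

<-unpair₁ : ∀ {n f} → n < f → unpair₁ n < f
<-unpair₁ {n} = ≤-<-trans (unpair₁≤ n)

<-unpair₂ : ∀ {n f} → n < f → unpair₂ n < f
<-unpair₂ {n} = ≤-<-trans (unpair₂≤ n)

-- A hole is decoded with whatever fuel is left, which is why fuel independence is needed.
mutual
  dec-fuel : ∀ {f g} n i → i < f → i < g → dec f n i ≡ dec g n i
  dec-fuel {suc f} {suc g} n zero    _         _         = refl
  dec-fuel {suc f} {suc g} n (suc k) (s≤s k<f) (s≤s k<g) =
    decTag-fuel n (unpair₁ k) (unpair₂ k) (<-unpair₂ k<f) (<-unpair₂ k<g)

  decTag-fuel : ∀ {f g} n t b → b < f → b < g → decTag f n t b ≡ decTag g n t b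
  decTag-fuel n             0 b _ _ = refl
  decTag-fuel zero          1 b _ _ = refl
  decTag-fuel (suc zero)    1 b _ _ = refl
  decTag-fuel (suc (suc n)) 1 b _ _ = refl
  decTag-fuel zero          2 b _ _ = refl
  decTag-fuel (suc zero)    2 b _ _ = refl
  decTag-fuel (suc (suc n)) 2 b _ _ = refl
  decTag-fuel zero          3 b b<f b<g = compose-fuel zero b b<f b<g
  decTag-fuel (suc zero)    3 b b<f b<g = compose-fuel (suc zero) b b<f b<g
  decTag-fuel (suc (suc n)) 3 b b<f b<g = compose-fuel (suc (suc n)) b b<f b<g
  decTag-fuel zero          4 b _ _ = refl
  decTag-fuel (suc zero)    4 b b<f b<g = recurse-fuel zero b b<f b<g
  decTag-fuel (suc (suc n)) 4 b b<f b<g = recurse-fuel (suc n) b b<f b<g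
  decTag-fuel zero          5 b b<f b<g = cong M (dec-fuel 1 b b<f b<g)
  decTag-fuel (suc zero)    5 b b<f b<g = cong M (dec-fuel 2 b b<f b<g)
  decTag-fuel (suc (suc n)) 5 b b<f b<g = cong M (dec-fuel (suc (suc (suc n))) b b<f b<g)
  decTag-fuel zero          (suc (suc (suc (suc (suc (suc t)))))) b _ _ = refl
  decTag-fuel (suc zero)    (suc (suc (suc (suc (suc (suc t)))))) b _ _ = refl
  decTag-fuel (suc (suc n)) (suc (suc (suc (suc (suc (suc t)))))) b _ _ = refl

  compose-fuel : ∀ {f g} n b → b < f → b < g →
    C (dec f (unpair₁ b) (unpair₁ (unpair₂ b))) (decVec f n (unpair₁ b) (unpair₂ (unpair₂ b))) ≡
    C (dec g (unpair₁ b) (unpair₁ (unpair₂ b))) (decVec g n (unpair₁ b) (unpair₂ (unpair₂ b)))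
  compose-fuel n b b<f b<g =
    cong₂ C (dec-fuel (unpair₁ b) _ (<-unpair₁ (<-unpair₂ b<f)) (<-unpair₁ (<-unpair₂ b<g)))
            (decVec-fuel n (unpair₁ b) _ (<-unpair₂ (<-unpair₂ b<f)) (<-unpair₂ (<-unpair₂ b<g)))

  recurse-fuel : ∀ {f g} n b → b < f → b < g →
    R (dec f n (unpair₁ b)) (dec f (suc (suc n)) (unpair₂ b)) ≡
    R (dec g n (unpair₁ b)) (dec g (suc (suc n)) (unpair₂ b))
  recurse-fuel n b b<f b<g =
    cong₂ R (dec-fuel n _ (<-unpair₁ b<f) (<-unpair₁ b<g))
            (dec-fuel (suc (suc n)) _ (<-unpair₂ b<f) (<-unpair₂ b<g))

  decVec-fuel : ∀ {f g} n m c → c < f → c < g → decVec f n m c ≡ decVec g n m c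
  decVec-fuel n zero    c _ _ = refl
  decVec-fuel n (suc m) c c<f c<g =
    cong₂ _∷_ (dec-fuel n _ (<-unpair₁ c<f) (<-unpair₁ c<g))
              (decVec-fuel n m _ (<-unpair₂ c<f) (<-unpair₂ c<g))

decTag-P : ∀ f n b → decTag f (suc n) 2 b ≡ P (clampFin n b)
decTag-P f zero    b = refl
decTag-P f (suc n) b = refl

decTag-C : ∀ f n b →
  decTag f n 3 b ≡ C (dec f (unpair₁ b) (unpair₁ (unpair₂ b))) (decVec f n (unpair₁ b) (unpair₂ (unpair₂ b)))
decTag-C f zero          b = refl
decTag-C f (suc zero)    b = refl
decTag-C f (suc (suc n)) b = refl

decTag-R : ∀ f n b → decTag f (suc n) 4 b ≡ R (dec f n (unpair₁ b)) (dec f (suc (suc n)) (unpair₂ b))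
decTag-R f zero    b = refl
decTag-R f (suc n) b = refl

decTag-M : ∀ f n b → decTag f n 5 b ≡ M (dec f (suc n) b)
decTag-M f zero          b = refl
decTag-M f (suc zero)    b = refl
decTag-M f (suc (suc n)) b = refl

clampFin-toℕ : ∀ n (i : Fin (suc n)) → clampFin n (F.toℕ i) ≡ i
clampFin-toℕ n       F.zero    = refl
clampFin-toℕ (suc n) (F.suc i) = cong F.suc (clampFin-toℕ n i)

-- Programs that may call φ_e for a parameter e; the code of the filled program is computable from e.
data Template : ℕ → Set where
  Z    : ∀ {n} → Template n
  S    : Template 1
  P    : ∀ {n} → Fin n → Template n
  C    : ∀ {m n} → Template m → Vec (Template n) m → Template n
  R    : ∀ {n} → Template n → Template (suc (suc n)) → Template (suc n)
  M    : ∀ {n} → Template (suc n) → Template n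
  hole : Template 1

mutual
  fill : ℕ → ∀ {n} → Template n → PR n
  fill e Z        = Z
  fill e S        = S
  fill e (P i)    = P i
  fill e (C f gs) = C (fill e f) (fillVec e gs)
  fill e (R g h)  = R (fill e g) (fill e h)
  fill e (M f)    = M (fill e f)
  fill e hole     = code e

  fillVec : ℕ → ∀ {n m} → Vec (Template n) m → Vec (PR n) m
  fillVec e []       = []
  fillVec e (t ∷ ts) = fill e t ∷ fillVec e ts

mutual
  fillCode : ℕ → ∀ {n} → Template n → ℕ
  fillCode e Z            = 0
  fillCode e S            = suc (pair 1 0)
  fillCode e (P i)        = suc (pair 2 (F.toℕ i))
  fillCode e (C {m} f gs) = suc (pair 3 (pair m (pair (fillCode e f) (fillCodeVec e gs))))
  fillCode e (R g h)      = suc (pair 4 (pair (fillCode e g) (fillCode e h)))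
  fillCode e (M f)        = suc (pair 5 (fillCode e f))
  fillCode e hole         = e

  fillCodeVec : ℕ → ∀ {n m} → Vec (Template n) m → ℕ
  fillCodeVec e []       = 0
  fillCodeVec e (t ∷ ts) = pair (fillCode e t) (fillCodeVec e ts)

mutual
  dec-fillCode : ∀ e f {n} (t : Template n) → fillCode e t < f → dec f n (fillCode e t) ≡ fill e t
  dec-fillCode e (suc f) Z _ = refl
  dec-fillCode e (suc f) S _ = refl
  dec-fillCode e (suc f) {suc n} (P i) _
    rewrite unpair-pair 2 (F.toℕ i) = trans (decTag-P f n (F.toℕ i)) (cong P (clampFin-toℕ n i))
  dec-fillCode e (suc f) {n} (C {m} g gs) (s≤s c<f)
    rewrite unpair-pair 3 (pair m (pair (fillCode e g) (fillCodeVec e gs)))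
          | decTag-C f n (pair m (pair (fillCode e g) (fillCodeVec e gs)))
          | unpair-pair m (pair (fillCode e g) (fillCodeVec e gs))
          | unpair-pair (fillCode e g) (fillCodeVec e gs) =
    let inner<f = pair[m,n]<o⇒n<o m _ (pair[m,n]<o⇒n<o 3 _ c<f) in
    cong₂ C (dec-fillCode e f g (pair[m,n]<o⇒m<o (fillCode e g) (fillCodeVec e gs) inner<f))
            (dec-fillCodeVec e f gs (pair[m,n]<o⇒n<o (fillCode e g) (fillCodeVec e gs) inner<f))
  dec-fillCode e (suc f) {suc n} (R g h) (s≤s c<f)
    rewrite unpair-pair 4 (pair (fillCode e g) (fillCode e h))
          | decTag-R f n (pair (fillCode e g) (fillCode e h))
          | unpair-pair (fillCode e g) (fillCode e h) =
    let inner<f = pair[m,n]<o⇒n<o 4 _ c<f in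
    cong₂ R (dec-fillCode e f g (pair[m,n]<o⇒m<o (fillCode e g) (fillCode e h) inner<f))
            (dec-fillCode e f h (pair[m,n]<o⇒n<o (fillCode e g) (fillCode e h) inner<f))
  dec-fillCode e (suc f) {n} (M g) (s≤s c<f)
    rewrite unpair-pair 5 (fillCode e g) | decTag-M f n (fillCode e g) =
    cong M (dec-fillCode e f g (pair[m,n]<o⇒n<o 5 _ c<f))
  dec-fillCode e f hole e<f = dec-fuel 1 e e<f ≤-refl

  dec-fillCodeVec : ∀ e f {n m} (ts : Vec (Template n) m) → fillCodeVec e ts < f →
                    decVec f n m (fillCodeVec e ts) ≡ fillVec e ts
  dec-fillCodeVec e f []       _ = refl
  dec-fillCodeVec e f (t ∷ ts) c<f rewrite unpair-pair (fillCode e t) (fillCodeVec e ts) =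
    cong₂ _∷_ (dec-fillCode e f t (pair[m,n]<o⇒m<o (fillCode e t) (fillCodeVec e ts) c<f))
              (dec-fillCodeVec e f ts (pair[m,n]<o⇒n<o (fillCode e t) (fillCodeVec e ts) c<f))

code-fillCode : ∀ e (t : Template 1) → code (fillCode e t) ≡ fill e t
code-fillCode e t = dec-fillCode e (suc (fillCode e t)) t ≤-refl

mutual
  template : ∀ {n} → PR n → Template n
  template Z        = Z
  template S        = S
  template (P i)    = P i
  template (C f gs) = C (template f) (templateVec gs)
  template (R g h)  = R (template g) (template h)
  template (M f)    = M (template f)

  templateVec : ∀ {n m} → Vec (PR n) m → Vec (Template n) m
  templateVec []       = []
  templateVec (p ∷ ps) = template p ∷ templateVec ps

mutual
  fill-template : ∀ e {n} (p : PR n) → fill e (template p) ≡ p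
  fill-template e Z        = refl
  fill-template e S        = refl
  fill-template e (P i)    = refl
  fill-template e (C f gs) = cong₂ C (fill-template e f) (fillVec-templateVec e gs)
  fill-template e (R g h)  = cong₂ R (fill-template e g) (fill-template e h)
  fill-template e (M f)    = cong M (fill-template e f)

  fillVec-templateVec : ∀ e {n m} (ps : Vec (PR n) m) → fillVec e (templateVec ps) ≡ ps
  fillVec-templateVec e []       = refl
  fillVec-templateVec e (p ∷ ps) = cong₂ _∷_ (fill-template e p) (fillVec-templateVec e ps)

mutual
  Eval-deterministic : ∀ {n} {p : PR n} {xs y y′} → Eval p xs y → Eval p xs y′ → y ≡ y′
  Eval-deterministic evZ evZ = refl
  Eval-deterministic evS evS = refl
  Eval-deterministic evP evP = refl
  Eval-deterministic (evC gs f) (evC gs′ f′) with EvalVec-deterministic gs gs′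
  ... | refl = Eval-deterministic f f′
  Eval-deterministic (evR0 g) (evR0 g′) = Eval-deterministic g g′
  Eval-deterministic (evRS r h) (evRS r′ h′) with Eval-deterministic r r′
  ... | refl = Eval-deterministic h h′
  Eval-deterministic (evM {y = y} f below) (evM {y = y′} f′ below′) with <-cmp y y′
  ... | tri≈ _ refl _ = refl
  ... | tri< y<y′ _ _ with Eval-deterministic f (proj₂ (below′ y y<y′))
  ...   | ()
  Eval-deterministic (evM {y = y} f below) (evM {y = y′} f′ below′) | tri> _ _ y′<y
    with Eval-deterministic f′ (proj₂ (below y′ y′<y))
  ... | ()

  EvalVec-deterministic : ∀ {n m} {ps : Vec (PR n) m} {xs ys ys′} →
                          EvalVec ps xs ys → EvalVec ps xs ys′ → ys ≡ ys′
  EvalVec-deterministic []       []         = refl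
  EvalVec-deterministic (p ∷ ps) (p′ ∷ ps′) =
    cong₂ _∷_ (Eval-deterministic p p′) (EvalVec-deterministic ps ps′)

φ-deterministic : ∀ e {x y y′} → φ e x y → φ e x y′ → y ≡ y′
φ-deterministic e = Eval-deterministic

-- The combinators below keep fun definitionally equal to the intended function, so a test built
-- from them unfolds to its ℕ-valued meaning.
record Computation (n : ℕ) : Set where
  field
    prog : PR n
    fun  : Vec ℕ n → ℕ
    eval : ∀ xs → Eval prog xs (fun xs)
open Computation public

var : ∀ {n} → Fin n → Computation n
var i = record { prog = P i ; fun = λ xs → lookup xs i ; eval = λ _ → evP }

const : ∀ {n} → ℕ → Computation n
const {n} k = record { prog = numeral k ; fun = λ _ → k ; eval = λ xs → eval-numeral k }
  where
  numeral : ℕ → PR n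
  numeral zero    = Z
  numeral (suc k) = C S (numeral k ∷ [])
  eval-numeral : ∀ {xs} k → Eval (numeral k) xs k
  eval-numeral zero    = evZ
  eval-numeral (suc k) = evC (eval-numeral k ∷ []) evS

app : ∀ {m n} → Computation m → Vec (Computation n) m → Computation n
app f gs = record
  { prog = C (prog f) (V.map prog gs)
  ; fun  = λ xs → fun f (V.map (λ g → fun g xs) gs)
  ; eval = λ xs → evC (evalAll gs xs) (eval f _)
  }
  where
  evalAll : ∀ {m n} (gs : Vec (Computation n) m) xs →
            EvalVec (V.map prog gs) xs (V.map (λ g → fun g xs) gs)
  evalAll []       xs = []
  evalAll (g ∷ gs) xs = eval g xs ∷ evalAll gs xs

primRec : ∀ {n} (f : ℕ → Vec ℕ n → ℕ) (g : Computation n) (h : Computation (suc (suc n))) →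
          (∀ xs → f 0 xs ≡ fun g xs) → (∀ k xs → f (suc k) xs ≡ fun h (k ∷ f k xs ∷ xs)) →
          Computation (suc n)
primRec {n} f g h f0 fsuc = record { prog = R (prog g) (prog h) ; fun = uncurry₁ ; eval = evalR }
  where
  uncurry₁ : Vec ℕ (suc n) → ℕ
  uncurry₁ (k ∷ xs) = f k xs
  evalR : ∀ xs → Eval (R (prog g) (prog h)) xs (uncurry₁ xs)
  evalR (zero  ∷ xs) = evR0 (subst (Eval (prog g) xs) (sym (f0 xs)) (eval g xs))
  evalR (suc k ∷ xs) = evRS (evalR (k ∷ xs)) (subst (Eval (prog h) _) (sym (fsuc k xs)) (eval h _))

computing : ∀ {n} (c : Computation n) (f : Vec ℕ n → ℕ) → (∀ xs → fun c xs ≡ f xs) → Computation n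
computing c f eq = record { prog = prog c ; fun = f ; eval = λ xs → subst (Eval (prog c) xs) (eq xs) (eval c xs) }

ifz : ℕ → ℕ → ℕ → ℕ
ifz zero    a b = a
ifz (suc _) a b = b

lift₁ : ∀ {n} → Computation 1 → Computation n → Computation n
lift₁ f a = app f (a ∷ [])

lift₂ : ∀ {n} → Computation 2 → Computation n → Computation n → Computation n
lift₂ f a b = app f (a ∷ b ∷ [])

lift₃ : ∀ {n} → Computation 3 → Computation n → Computation n → Computation n → Computation n
lift₃ f a b c = app f (a ∷ b ∷ c ∷ [])

sucᶜ : ∀ {n} → Computation n → Computation n
sucᶜ = lift₁ (record { prog = S ; fun = λ { (x ∷ []) → suc x } ; eval = λ { (x ∷ []) → evS } })

predᶜ : ∀ {n} → Computation n → Computation n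
predᶜ = lift₁ (primRec (λ k _ → N.pred k) (const 0) (var (# 0)) (λ _ → refl) (λ _ _ → refl))

infixl 6 _+ᶜ_ _∸ᶜ_

_+ᶜ_ : ∀ {n} → Computation n → Computation n → Computation n
_+ᶜ_ = lift₂ (primRec (λ k xs → k + V.head xs) (var (# 0)) (sucᶜ (var (# 1)))
                      (λ { (_ ∷ []) → refl }) (λ _ _ → refl))

_∸ᶜ_ : ∀ {n} → Computation n → Computation n → Computation n
a ∸ᶜ b = lift₂ (primRec (λ k xs → V.head xs ∸ k) (var (# 0)) (predᶜ (var (# 1)))
                        (λ { (_ ∷ []) → refl }) (λ { k (a ∷ []) → sym (pred[m∸n]≡m∸[1+n] a k) })) b a

ifzᶜ : ∀ {n} → Computation n → Computation n → Computation n → Computation n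
ifzᶜ = lift₃ (primRec (λ c xs → ifz c (V.head xs) (V.head (V.tail xs)))
                      (var (# 0)) (var (# 3))
                      (λ { (_ ∷ _ ∷ []) → refl }) (λ { _ (_ ∷ _ ∷ []) → refl }))

triᶜ : ∀ {n} → Computation n → Computation n
triᶜ = lift₁ (primRec (λ k _ → tri k) (const 0) (sucᶜ (var (# 0)) +ᶜ var (# 1))
                      (λ _ → refl) (λ _ _ → refl))

pairᶜ : ∀ {n} → Computation n → Computation n → Computation n
pairᶜ a b = triᶜ (a +ᶜ b) +ᶜ b

Holds : ℕ → Set
Holds zero    = ⊥
Holds (suc _) = ⊤

infix 0 _decides_
_decides_ : ℕ → Set → Set
c decides A = Holds c ⇔ A

infixr 6 _∧ⁿ_
infixr 5 _∨ⁿ_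
infixr 4 _⇒ⁿ_
infix 3 _⇔ⁿ_
infix 7 _≤ⁿ_ _≡ⁿ_

_∧ⁿ_ _∨ⁿ_ _⇒ⁿ_ _⇔ⁿ_ _≤ⁿ_ _≡ⁿ_ : ℕ → ℕ → ℕ
a ∧ⁿ b = ifz a 0 b
a ∨ⁿ b = ifz a b 1
a ⇒ⁿ b = ifz a 1 b
a ⇔ⁿ b = (a ⇒ⁿ b) ∧ⁿ (b ⇒ⁿ a)
a ≤ⁿ b = ifz (a ∸ b) 1 0
a ≡ⁿ b = a ≤ⁿ b ∧ⁿ b ≤ⁿ a

allBelow : (ℕ → ℕ) → ℕ → ℕ
allBelow f zero    = 1
allBelow f (suc k) = allBelow f k ∧ⁿ f k

decides-⇔ : ∀ {c P Q} → c decides P → P ⇔ Q → c decides Q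
decides-⇔ (c⇒P , P⇒c) (P⇒Q , Q⇒P) = (λ h → P⇒Q (c⇒P h)) , (λ q → P⇒c (Q⇒P q))

∧ⁿ-decides : ∀ {a b P Q} → a decides P → b decides Q → a ∧ⁿ b decides P × Q
∧ⁿ-decides {zero}  (_ , P⇒a) _ = ⊥-elim , λ (p , _) → P⇒a p
∧ⁿ-decides {suc _} (a⇒P , _) (b⇒Q , Q⇒b) = (λ h → a⇒P tt , b⇒Q h) , λ (_ , q) → Q⇒b q

∨ⁿ-decides : ∀ {a b P Q} → a decides P → b decides Q → a ∨ⁿ b decides P ⊎ Q
∨ⁿ-decides {zero}  (_ , P⇒a) (b⇒Q , Q⇒b) = (λ h → inj₂ (b⇒Q h)) , λ { (inj₁ p) → ⊥-elim (P⇒a p) ; (inj₂ q) → Q⇒b q }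
∨ⁿ-decides {suc _} (a⇒P , _) _ = (λ _ → inj₁ (a⇒P tt)) , λ _ → tt

⇒ⁿ-decides : ∀ {a b P Q} → a decides P → (P → b decides Q) → a ⇒ⁿ b decides (P → Q)
⇒ⁿ-decides {zero}  (_ , P⇒a) _ = (λ _ p → ⊥-elim (P⇒a p)) , λ _ → tt
⇒ⁿ-decides {suc _} (a⇒P , _) b⇔Q = (λ h p → proj₁ (b⇔Q p) h) , λ f → proj₂ (b⇔Q (a⇒P tt)) (f (a⇒P tt))

⇔ⁿ-decides : ∀ {a b P Q} → a decides P → b decides Q → a ⇔ⁿ b decides (P ⇔ Q)
⇔ⁿ-decides aP bQ = ∧ⁿ-decides (⇒ⁿ-decides aP (λ _ → bQ)) (⇒ⁿ-decides bQ (λ _ → aP))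

≤ⁿ-decides : ∀ a b → a ≤ⁿ b decides a ≤ b
≤ⁿ-decides a b with a ∸ b in eq
... | zero  = (λ _ → m∸n≡0⇒m≤n eq) , λ _ → tt
... | suc _ = ⊥-elim , λ a≤b → 0≢1+n (trans (sym (m≤n⇒m∸n≡0 a≤b)) eq)

≡ⁿ-decides : ∀ a b → a ≡ⁿ b decides a ≡ b
≡ⁿ-decides a b = decides-⇔ (∧ⁿ-decides (≤ⁿ-decides a b) (≤ⁿ-decides b a))
  ((λ (a≤b , b≤a) → ≤-antisym a≤b b≤a) , λ { refl → ≤-refl , ≤-refl })

allBelow-decides : ∀ {P : ℕ → Set} f k → (∀ i → i < k → f i decides P i) →
                   allBelow f k decides (∀ i → i < k → P i)
allBelow-decides f zero    _  = (λ _ _ ()) , λ _ → tt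
allBelow-decides f (suc k) fP = decides-⇔
  (∧ⁿ-decides (allBelow-decides f k (λ i i<k → fP i (m≤n⇒m≤1+n i<k))) (fP k ≤-refl))
  ( (λ (below , Pk) i i<1+k → extend below Pk i (m≤n⇒m<n∨m≡n (N.s≤s⁻¹ i<1+k)))
  , λ all → (λ i i<k → all i (m≤n⇒m≤1+n i<k)) , all k ≤-refl )
  where
  extend : ∀ {P : ℕ → Set} {k} → (∀ i → i < k → P i) → P k → ∀ i → i < k ⊎ i ≡ k → P i
  extend below Pk i (inj₁ i<k)  = below i i<k
  extend below Pk i (inj₂ refl) = Pk

infixr 6 _∧ᶜ_
infixr 5 _∨ᶜ_
infixr 4 _⇒ᶜ_
infix 3 _⇔ᶜ_
infix 7 _≤ᶜ_ _≡ᶜ_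

_∧ᶜ_ _∨ᶜ_ _⇒ᶜ_ _⇔ᶜ_ _≤ᶜ_ _≡ᶜ_ : ∀ {n} → Computation n → Computation n → Computation n
a ∧ᶜ b = ifzᶜ a (const 0) b
a ∨ᶜ b = ifzᶜ a b (const 1)
a ⇒ᶜ b = ifzᶜ a (const 1) b
a ⇔ᶜ b = (a ⇒ᶜ b) ∧ᶜ (b ⇒ᶜ a)
a ≤ᶜ b = ifzᶜ (a ∸ᶜ b) (const 1) (const 0)
a ≡ᶜ b = a ≤ᶜ b ∧ᶜ b ≤ᶜ a

allBelowᶜ : ∀ {n} → Computation (suc n) → Computation (suc n)
allBelowᶜ {n} c = primRec (λ k xs → allBelow (λ i → fun c (i ∷ xs)) k) (const 1)
  (var (# 1) ∧ᶜ app c (var (# 0) ∷ tabulate (λ j → var (F.suc (F.suc j)))))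
  (λ _ → refl)
  (λ k xs → cong (λ ys → allBelow (λ i → fun c (i ∷ xs)) k ∧ⁿ fun c (k ∷ ys)) (sym (dropTwo k _ xs)))
  where
  dropTwo : ∀ a b (xs : Vec ℕ n) → V.map (λ g → fun g (a ∷ b ∷ xs)) (tabulate (λ j → var (F.suc (F.suc j)))) ≡ xs
  dropTwo a b xs = trans (sym (tabulate-∘ (λ g → fun g (a ∷ b ∷ xs)) _)) (tabulate∘lookup xs)

diagonal : ℕ → ℕ
diagonal zero    = zero
diagonal (suc n) = ifz (tri (suc (diagonal n)) ≤ⁿ suc n) (diagonal n) (suc (diagonal n))

diagonal-bounds : ∀ n → tri (diagonal n) ≤ n × n < tri (suc (diagonal n))
diagonal-bounds zero = z≤n , s≤s z≤n
diagonal-bounds (suc n) with diagonal-bounds n | tri (suc (diagonal n)) ≤ⁿ suc n in eq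
... | lower , upper | zero  =
  m≤n⇒m≤1+n lower , ≰⇒> (λ next≤ → subst Holds eq (proj₂ (≤ⁿ-decides (tri (suc (diagonal n))) (suc n)) next≤))
... | lower , upper | suc _ =
  proj₁ (≤ⁿ-decides (tri (suc (diagonal n))) (suc n)) (subst Holds (sym eq) tt) ,
  s≤s (≤-trans upper (m≤n+m (tri (suc (diagonal n))) (suc (diagonal n))))

unpair-via-diagonal : ∀ n → unpair n ≡ (diagonal n ∸ (n ∸ tri (diagonal n)) , n ∸ tri (diagonal n))
unpair-via-diagonal n = begin
  unpair n                ≡⟨ cong unpair n≡pair ⟩
  unpair (pair (s ∸ b) b) ≡⟨ unpair-pair (s ∸ b) b ⟩
  (s ∸ b , b)             ∎
  where
  open ≡-Reasoning
  s b : ℕ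
  s = diagonal n
  b = n ∸ tri s
  b≤s : b ≤ s
  b≤s = N.s≤s⁻¹ (subst (b <_) (m+n∸n≡m (suc s) (tri s))
                       (∸-monoˡ-< (proj₂ (diagonal-bounds n)) (proj₁ (diagonal-bounds n))))
  n≡pair : n ≡ pair (s ∸ b) b
  n≡pair = sym (trans (cong (λ d → tri d + b) (m∸n+n≡m b≤s)) (m+[n∸m]≡n (proj₁ (diagonal-bounds n))))

diagonalᶜ : ∀ {n} → Computation n → Computation n
diagonalᶜ = lift₁ (primRec (λ k _ → diagonal k) (const 0)
  (ifzᶜ (triᶜ (sucᶜ (var (# 1))) ≤ᶜ sucᶜ (var (# 0))) (var (# 1)) (sucᶜ (var (# 1))))
  (λ _ → refl) (λ _ _ → refl))

unpair₁ᶜ unpair₂ᶜ : ∀ {n} → Computation n → Computation n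
unpair₁ᶜ = lift₁ (computing (diagonalᶜ n ∸ᶜ (n ∸ᶜ triᶜ (diagonalᶜ n)))
                            (λ { (n ∷ []) → unpair₁ n }) λ { (n ∷ []) → cong proj₁ (sym (unpair-via-diagonal n)) })
  where n : Computation 1
        n = var (# 0)
unpair₂ᶜ = lift₁ (computing (n ∸ᶜ triᶜ (diagonalᶜ n))
                            (λ { (n ∷ []) → unpair₂ n }) λ { (n ∷ []) → cong proj₂ (sym (unpair-via-diagonal n)) })
  where n : Computation 1
        n = var (# 0)

infixl 9 _!_ _!ⁿ_

-- out of range the entry is 0
_!_ : List ℕ → ℕ → ℕ
[]      ! _     = 0
(a ∷ s) ! zero  = a
(a ∷ s) ! suc i = s ! i

!-++ˡ : ∀ s t i → i < L.length s → (s ++ t) ! i ≡ s ! i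
!-++ˡ (a ∷ s) t zero    _         = refl
!-++ˡ (a ∷ s) t (suc i) (s≤s i<n) = !-++ˡ s t i i<n

!-applyUpTo : ∀ (f : ℕ → ℕ) n i → i < n → L.applyUpTo f n ! i ≡ f i
!-applyUpTo f (suc n) zero    _         = refl
!-applyUpTo f (suc n) (suc i) (s≤s i<n) = !-applyUpTo (λ k → f (suc k)) n i i<n

!-mapUpTo : ∀ (p : ℕ → ℕ) n i → i < n → L.map p (L.upTo n) ! i ≡ p i
!-mapUpTo p n i i<n = trans (cong (_! i) (map-upTo p n)) (!-applyUpTo p n i i<n)

length-mapUpTo : ∀ (p : ℕ → ℕ) n → L.length (L.map p (L.upTo n)) ≡ n
length-mapUpTo p n = trans (length-map p (L.upTo n)) (length-upTo n)

mapUpTo-suc : ∀ (p : ℕ → ℕ) k → L.map p (L.upTo (suc k)) ≡ L.map p (L.upTo k) ∷ʳ p k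
mapUpTo-suc p k = trans (cong (L.map p) (sym (upTo-∷ʳ k))) (map-++ p (L.upTo k) (k ∷ []))

length-∷ʳ : ∀ (τ : List ℕ) a → L.length (τ ∷ʳ a) ≡ suc (L.length τ)
length-∷ʳ τ a = trans (length-++ τ) (+-comm (L.length τ) 1)

headⁿ tailⁿ : ℕ → ℕ
headⁿ c = unpair₁ (N.pred c)
tailⁿ c = unpair₂ (N.pred c)

dropⁿ : ℕ → ℕ → ℕ
dropⁿ zero    c = c
dropⁿ (suc i) c = tailⁿ (dropⁿ i c)

_!ⁿ_ : ℕ → ℕ → ℕ
c !ⁿ i = headⁿ (dropⁿ i c)

dropⁿ-strCode : ∀ i s → dropⁿ i (strCode s) ≡ strCode (L.drop i s)
dropⁿ-strCode zero    s = refl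
dropⁿ-strCode (suc i) s = trans (cong tailⁿ (dropⁿ-strCode i s)) (tail-drop i s)
  where
  tail-drop : ∀ i s → tailⁿ (strCode (L.drop i s)) ≡ strCode (L.drop (suc i) s)
  tail-drop zero    []      = refl
  tail-drop zero    (a ∷ s) = unpair₂-pair a (strCode s)
  tail-drop (suc i) []      = refl
  tail-drop (suc i) (a ∷ s) = tail-drop i s

!ⁿ-strCode : ∀ s i → strCode s !ⁿ i ≡ s ! i
!ⁿ-strCode s i = trans (cong headⁿ (dropⁿ-strCode i s)) (head-drop i s)
  where
  head-drop : ∀ i s → headⁿ (strCode (L.drop i s)) ≡ s ! i
  head-drop zero    []      = refl
  head-drop (suc i) []      = refl
  head-drop zero    (a ∷ s) = unpair₁-pair a (strCode s)
  head-drop (suc i) (a ∷ s) = head-drop i s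

!ⁿ-cons : ∀ a r i → suc (pair a r) !ⁿ suc i ≡ r !ⁿ i
!ⁿ-cons a r i = cong headⁿ (trans (drop-suc i (suc (pair a r))) (cong (dropⁿ i) (unpair₂-pair a r)))
  where
  drop-suc : ∀ i c → dropⁿ (suc i) c ≡ dropⁿ i (tailⁿ c)
  drop-suc zero    c = refl
  drop-suc (suc i) c = cong tailⁿ (drop-suc i c)

dropⁿ-decides : ∀ i s → dropⁿ i (strCode s) decides i < L.length s
dropⁿ-decides i s = subst (_decides i < L.length s) (sym (dropⁿ-strCode i s)) (drop-decides i s)
  where
  drop-decides : ∀ i s → strCode (L.drop i s) decides i < L.length s
  drop-decides zero    []      = ⊥-elim , λ ()
  drop-decides (suc i) []      = ⊥-elim , λ ()
  drop-decides zero    (a ∷ s) = (λ _ → s≤s z≤n) , λ _ → tt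
  drop-decides (suc i) (a ∷ s) = decides-⇔ (drop-decides i s) (s≤s , N.s≤s⁻¹)

!<strCode : ∀ s i → i < L.length s → s ! i < strCode s
!<strCode (a ∷ s) zero    _         = s≤s (m≤pair[m,n] a (strCode s))
!<strCode (a ∷ s) (suc i) (s≤s i<n) = m≤n⇒m≤1+n (<-≤-trans (!<strCode s i i<n) (n≤pair[m,n] a (strCode s)))

headᶜ tailᶜ : ∀ {n} → Computation n → Computation n
headᶜ c = unpair₁ᶜ (predᶜ c)
tailᶜ c = unpair₂ᶜ (predᶜ c)

dropᶜ : ∀ {n} → Computation n → Computation n → Computation n
dropᶜ i c = lift₂ (primRec (λ k xs → dropⁿ k (V.head xs)) (var (# 0)) (tailᶜ (var (# 1)))
                           (λ { (_ ∷ []) → refl }) (λ _ _ → refl)) i c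

_!ᶜ_ : ∀ {n} → Computation n → Computation n → Computation n
c !ᶜ i = headᶜ (dropᶜ i c)

computation-computable : (c : Computation 1) → TotalComputable (λ x → fun c (x ∷ []))
computation-computable c = fillCode 0 (template (prog c)) , λ x →
  subst (λ p → Eval p (x ∷ []) _) (sym (trans (code-fillCode 0 (template (prog c))) (fill-template 0 (prog c))))
        (eval c (x ∷ []))

mutual
  fillCodeᶜ : ∀ {n} → Template n → Computation 1
  fillCodeᶜ Z            = const 0
  fillCodeᶜ S            = const (suc (pair 1 0))
  fillCodeᶜ (P i)        = const (suc (pair 2 (F.toℕ i)))
  fillCodeᶜ (C {m} f gs) = sucᶜ (pairᶜ (const 3) (pairᶜ (const m) (pairᶜ (fillCodeᶜ f) (fillCodeVecᶜ gs))))
  fillCodeᶜ (R g h)      = sucᶜ (pairᶜ (const 4) (pairᶜ (fillCodeᶜ g) (fillCodeᶜ h)))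
  fillCodeᶜ (M f)        = sucᶜ (pairᶜ (const 5) (fillCodeᶜ f))
  fillCodeᶜ hole         = var (# 0)

  fillCodeVecᶜ : ∀ {n m} → Vec (Template n) m → Computation 1
  fillCodeVecᶜ []       = const 0
  fillCodeVecᶜ (t ∷ ts) = pairᶜ (fillCodeᶜ t) (fillCodeVecᶜ ts)

mutual
  fun-fillCodeᶜ : ∀ e {n} (t : Template n) → fun (fillCodeᶜ t) (e ∷ []) ≡ fillCode e t
  fun-fillCodeᶜ e Z        = refl
  fun-fillCodeᶜ e S        = refl
  fun-fillCodeᶜ e (P i)    = refl
  fun-fillCodeᶜ e (C {m} f gs) =
    cong (λ c → suc (pair 3 (pair m c))) (cong₂ pair (fun-fillCodeᶜ e f) (fun-fillCodeVecᶜ e gs))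
  fun-fillCodeᶜ e (R g h)  = cong (λ c → suc (pair 4 c)) (cong₂ pair (fun-fillCodeᶜ e g) (fun-fillCodeᶜ e h))
  fun-fillCodeᶜ e (M f)    = cong (λ c → suc (pair 5 c)) (fun-fillCodeᶜ e f)
  fun-fillCodeᶜ e hole     = refl

  fun-fillCodeVecᶜ : ∀ e {n m} (ts : Vec (Template n) m) → fun (fillCodeVecᶜ ts) (e ∷ []) ≡ fillCodeVec e ts
  fun-fillCodeVecᶜ e []       = refl
  fun-fillCodeVecᶜ e (t ∷ ts) = cong₂ pair (fun-fillCodeᶜ e t) (fun-fillCodeVecᶜ e ts)

fillCode-computable : (t : Template 1) → TotalComputable (λ e → fillCode e t)
fillCode-computable t = computation-computable
  (computing (fillCodeᶜ t) (λ { (e ∷ []) → fillCode e t }) λ { (e ∷ []) → fun-fillCodeᶜ e t })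

Eval-fill-template : ∀ e {n} (p : PR n) {xs y} → Eval (fill e (template p)) xs y → Eval p xs y
Eval-fill-template e p {xs} {y} = subst (λ q → Eval q xs y) (fill-template e p)

Eval-fill-template⁻ : ∀ e {n} (p : PR n) {xs y} → Eval p xs y → Eval (fill e (template p)) xs y
Eval-fill-template⁻ e p {xs} {y} = subst (λ q → Eval q xs y) (sym (fill-template e p))

listed : ℕ → ℕ → ℕ → ℕ
listed x v j = v !ⁿ (x ∸ j)

-- v codes the string φ_e(x) , φ_e(x - 1) , … , φ_e(0)
record Listing (e x v : ℕ) : Set where
  field
    φ-listed : ∀ j → j ≤ x → φ e j (listed x v j)
open Listing public

consᶜ : Computation 2
consᶜ = sucᶜ (pairᶜ (var (# 0)) (var (# 1)))

opaque
  consTemplate : Template 2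
  consTemplate = template (prog consᶜ)

  fill-consTemplate : ∀ e → fill e consTemplate ≡ prog consᶜ
  fill-consTemplate e = fill-template e (prog consᶜ)

listingTemplate : Template 1
listingTemplate = R (C consTemplate (C hole (Z ∷ []) ∷ Z ∷ []))
                    (C consTemplate (C hole (C S (P (# 0) ∷ []) ∷ []) ∷ P (# 1) ∷ []))

module _ (e : ℕ) where

  private
    Eval-cons : ∀ {a r y} → Eval (fill e consTemplate) (a ∷ r ∷ []) y → y ≡ suc (pair a r)
    Eval-cons ev = Eval-deterministic (subst (λ p → Eval p _ _) (fill-consTemplate e) ev) (eval consᶜ _)

    Eval-cons⁻ : ∀ a r → Eval (fill e consTemplate) (a ∷ r ∷ []) (suc (pair a r))
    Eval-cons⁻ a r = subst (λ p → Eval p _ _) (sym (fill-consTemplate e)) (eval consᶜ (a ∷ r ∷ []))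

  Eval-listing : ∀ {x v} → Eval (fill e listingTemplate) (x ∷ []) v → Listing e x v
  Eval-listing ev = record { φ-listed = Eval-listed ev }
    where
    Eval-listed : ∀ {x v} → Eval (fill e listingTemplate) (x ∷ []) v → ∀ j → j ≤ x → φ e j (listed x v j)
    Eval-listed (evR0 (evC (evC (evZ ∷ []) φ₀ ∷ evZ ∷ []) cons)) zero z≤n
      rewrite Eval-cons cons | n∸n≡0 0 = subst (φ e 0) (sym (unpair₁-pair _ 0)) φ₀
    Eval-listed {suc k} (evRS {z = r} ev (evC {ys = a ∷ _} (evC (evC (evP ∷ []) evS ∷ []) φₖ ∷ evP ∷ []) cons)) j j≤1+k
      rewrite Eval-cons cons with m≤n⇒m<n∨m≡n j≤1+k
    ... | inj₂ refl rewrite n∸n≡0 (suc k) = subst (φ e (suc k)) (sym (unpair₁-pair _ r)) φₖ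
    ... | inj₁ (s≤s j≤k) rewrite +-∸-assoc 1 j≤k = subst (φ e j) (sym (!ⁿ-cons a r (k ∸ j))) (Eval-listed ev j j≤k)

  Eval-listing-total : IsCharFn e → ∀ x → Σ ℕ λ v → Eval (fill e listingTemplate) (x ∷ []) v
  Eval-listing-total isChar = go
    where
    value : ∀ j → Σ ℕ (φ e j)
    value j with isChar j
    ... | inj₁ φ₀ = 0 , φ₀
    ... | inj₂ φ₁ = 1 , φ₁
    go : ∀ x → Σ ℕ λ v → Eval (fill e listingTemplate) (x ∷ []) v
    go zero    = _ , evR0 (evC (evC (evZ ∷ []) (proj₂ (value 0)) ∷ evZ ∷ []) (Eval-cons⁻ _ 0))
    go (suc k) = _ , evRS (proj₂ (go k))
                          (evC (evC (evC (evP ∷ []) evS ∷ []) (proj₂ (value (suc k))) ∷ evP ∷ []) (Eval-cons⁻ _ _))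

reductionTemplate : Computation 2 → Template 1
reductionTemplate H = C (template (prog H)) (P (# 0) ∷ listingTemplate ∷ [])

-- Opaque, so that the unary arithmetic of the code is never unfolded.
opaque
  reduction : Computation 2 → ℕ → ℕ
  reduction H e = fillCode e (reductionTemplate H)

  reduction-computable : ∀ H → TotalComputable (reduction H)
  reduction-computable H = fillCode-computable (reductionTemplate H)

  code-reduction : ∀ H e → code (reduction H e) ≡ fill e (reductionTemplate H)
  code-reduction H e = code-fillCode e (reductionTemplate H)

module _ (H : Computation 2) (e : ℕ) where

  φ-reduction⁻ : ∀ {x y} → φ (reduction H e) x y → Σ ℕ λ v → Listing e x v × y ≡ fun H (x ∷ v ∷ [])
  φ-reduction⁻ ev with subst (λ p → Eval p _ _) (code-reduction H e) ev
  ... | evC {ys = _ ∷ v ∷ []} (evP ∷ listing ∷ []) evH =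
    v , Eval-listing e listing , Eval-deterministic (Eval-fill-template e (prog H) evH) (eval H _)

  φ-reduction : IsCharFn e → ∀ x → Σ ℕ λ v → Listing e x v × φ (reduction H e) x (fun H (x ∷ v ∷ []))
  φ-reduction isChar x with Eval-listing-total e isChar x
  ... | v , listing = v , Eval-listing e listing ,
    subst (λ p → Eval p _ _) (sym (code-reduction H e))
          (evC (evP ∷ listing ∷ []) (Eval-fill-template⁻ e (prog H) (eval H _)))

Boolean : ℕ → Set
Boolean y = y ≡ 0 ⊎ y ≡ 1

-- The answer 2 keeps φ from being a characteristic function, so the guard g becomes part of IsCharFn.
guarded : ℕ → ℕ → ℕ
guarded g c = ifz g 2 (ifz c 0 1)

guarded-boolean : ∀ g c → Holds g → Boolean (guarded g c)
guarded-boolean (suc _) zero    _ = inj₁ refl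
guarded-boolean (suc _) (suc _) _ = inj₂ refl

guarded-boolean⁻ : ∀ g c → Boolean (guarded g c) → Holds g
guarded-boolean⁻ zero    c (inj₁ ())
guarded-boolean⁻ zero    c (inj₂ ())
guarded-boolean⁻ (suc _) c _ = tt

guarded≡1 : ∀ g c → guarded g c ≡ 1 → Holds c
guarded≡1 (suc _) (suc _) _ = tt

guarded≡1⁻ : ∀ g c → Holds g → Holds c → guarded g c ≡ 1
guarded≡1⁻ (suc _) (suc _) _ _ = refl

guardedReduction : Computation 2 → Computation 2 → ℕ → ℕ
guardedReduction G D = reduction (ifzᶜ G (const 2) (ifzᶜ D (const 0) (const 1)))

module GuardedReduction (G D : Computation 2) {e : ℕ} {Γ Q : ℕ → Set}
         (G-decides : ∀ {x v} → Listing e x v → fun G (x ∷ v ∷ []) decides Γ x)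
         (D-decides : ∀ {x v} → Listing e x v → fun D (x ∷ v ∷ []) decides Q x) where

  private
    H : Computation 2
    H = ifzᶜ G (const 2) (ifzᶜ D (const 0) (const 1))
    g d : ℕ → ℕ → ℕ
    g x v = fun G (x ∷ v ∷ [])
    d x v = fun D (x ∷ v ∷ [])

  guardedReduction-isCharFn : IsCharFn e → (∀ x → Γ x) → IsCharFn (guardedReduction G D e)
  guardedReduction-isCharFn isChar Γ-all x with φ-reduction H e isChar x
  ... | v , listing , φy with guarded-boolean (g x v) (d x v)
                                              (proj₂ (G-decides listing) (Γ-all x))
  ...   | inj₁ y≡0 = inj₁ (subst (φ (guardedReduction G D e) x) y≡0 φy)
  ...   | inj₂ y≡1 = inj₂ (subst (φ (guardedReduction G D e) x) y≡1 φy)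

  guardedReduction-isCharFn⁻ : IsCharFn (guardedReduction G D e) → ∀ x → Γ x
  guardedReduction-isCharFn⁻ isChar x = Γx (isChar x)
    where
    Γx : φ (guardedReduction G D e) x 0 ⊎ φ (guardedReduction G D e) x 1 → Γ x
    Γx (inj₁ φ₀) with φ-reduction⁻ H e φ₀
    ... | v , listing , 0≡ = proj₁ (G-decides listing) (guarded-boolean⁻ (g x v) (d x v) (inj₁ (sym 0≡)))
    Γx (inj₂ φ₁) with φ-reduction⁻ H e φ₁
    ... | v , listing , 1≡ = proj₁ (G-decides listing) (guarded-boolean⁻ (g x v) (d x v) (inj₂ (sym 1≡)))

  guardedReduction-inSet : IsCharFn e → (∀ x → Γ x) → ∀ {x} → Q x → InSet (guardedReduction G D e) x
  guardedReduction-inSet isChar Γ-all {x} Qx with φ-reduction H e isChar x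
  ... | v , listing , φy =
    subst (φ (guardedReduction G D e) x)
          (guarded≡1⁻ (g x v) (d x v) (proj₂ (G-decides listing) (Γ-all x)) (proj₂ (D-decides listing) Qx)) φy

  guardedReduction-inSet⁻ : ∀ {x} → InSet (guardedReduction G D e) x → Q x
  guardedReduction-inSet⁻ {x} φ₁ with φ-reduction⁻ H e φ₁
  ... | v , listing , 1≡ = proj₁ (D-decides listing) (guarded≡1 (g x v) (d x v) (sym 1≡))

listedᶜ : ∀ {n} → Computation n → Computation n → Computation n → Computation n
listedᶜ x v j = v !ᶜ (x ∸ᶜ j)

inputᶜ listingᶜ booleanGuardᶜ : Computation 2
inputᶜ        = var (# 0)
listingᶜ      = var (# 1)
booleanGuardᶜ = listedᶜ inputᶜ listingᶜ inputᶜ ≤ᶜ const 1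

module _ {e x v : ℕ} (listing : Listing e x v) where

  listed-decides : ∀ {j} → j ≤ x → listed x v j ≡ⁿ 1 decides φ e j 1
  listed-decides {j} j≤x = decides-⇔ (≡ⁿ-decides (listed x v j) 1)
    ((λ eq → subst (φ e j) eq (φ-listed listing j j≤x)) , φ-deterministic e (φ-listed listing j j≤x))

  booleanGuard-decides : fun booleanGuardᶜ (x ∷ v ∷ []) decides φ e x 0 ⊎ φ e x 1
  booleanGuard-decides = decides-⇔ (≤ⁿ-decides (listed x v x) 1) (boolean (φ-listed listing x ≤-refl) , bounded)
    where
    boolean : ∀ {w} → φ e x w → w ≤ 1 → φ e x 0 ⊎ φ e x 1
    boolean {zero}  φw _ = inj₁ φw
    boolean {suc zero} φw _ = inj₂ φw
    boolean {suc (suc _)} _ (s≤s ())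
    bounded : φ e x 0 ⊎ φ e x 1 → listed x v x ≤ 1
    bounded (inj₁ φ₀) = ≤-trans (≤-reflexive (φ-deterministic e (φ-listed listing x ≤-refl) φ₀)) z≤n
    bounded (inj₂ φ₁) = ≤-reflexive (φ-deterministic e (φ-listed listing x ≤-refl) φ₁)

encodeℤ : ℤ → ℕ
encodeℤ (+ n)    = n + n
encodeℤ -[1+ n ] = suc (n + n)

private
  outward : ℤ → ℤ
  outward (+ n)    = + suc n
  outward -[1+ n ] = -[1+ suc n ]

decodeℤ : ℕ → ℤ
decodeℤ zero          = + 0
decodeℤ (suc zero)    = -[1+ 0 ]
decodeℤ (suc (suc a)) = outward (decodeℤ a)

decodeℤ-encodeℤ : ∀ X → decodeℤ (encodeℤ X) ≡ X
decodeℤ-encodeℤ (+ n)    = even n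
  where
  even : ∀ n → decodeℤ (n + n) ≡ + n
  even zero    = refl
  even (suc n) = trans (cong decodeℤ (+-suc (suc n) n)) (cong outward (even n))
decodeℤ-encodeℤ -[1+ n ] = odd n
  where
  odd : ∀ n → decodeℤ (suc (n + n)) ≡ -[1+ n ]
  odd zero    = refl
  odd (suc n) = trans (cong (λ m → decodeℤ (suc m)) (+-suc (suc n) n)) (cong outward (odd n))

encodeℤ-decodeℤ : ∀ a → encodeℤ (decodeℤ a) ≡ a
encodeℤ-decodeℤ zero          = refl
encodeℤ-decodeℤ (suc zero)    = refl
encodeℤ-decodeℤ (suc (suc a)) = trans (encodeℤ-outward (decodeℤ a)) (cong (λ m → suc (suc m)) (encodeℤ-decodeℤ a))
  where
  encodeℤ-outward : ∀ X → encodeℤ (outward X) ≡ suc (suc (encodeℤ X))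
  encodeℤ-outward (+ n)    = cong suc (+-suc n n)
  encodeℤ-outward -[1+ n ] = cong (λ m → suc (suc m)) (+-suc n n)

parity : ℕ → ℕ
parity zero    = 0
parity (suc n) = ifz (parity n) 1 0

encodedSuc : ℕ → ℕ
encodedSuc a = ifz (parity a) (a + 2) (ifz (a ∸ 1) 0 (a ∸ 2))

parity-even : ∀ n → parity (n + n) ≡ 0
parity-even zero    = refl
parity-even (suc n) rewrite +-suc n n | parity-even n = refl

encodedSuc-encodeℤ : ∀ X → encodedSuc (encodeℤ X) ≡ encodeℤ (X ℤ.+ ℤ.1ℤ)
encodedSuc-encodeℤ (+ n) rewrite parity-even n =
  trans (+-comm (n + n) 2) (trans (cong suc (sym (+-suc n n))) (cong (λ m → m + m) (+-comm 1 n)))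
encodedSuc-encodeℤ -[1+ zero ]  = refl
encodedSuc-encodeℤ -[1+ suc n ] rewrite +-suc n n | parity-even n = refl

decodeℤ-encodedSuc : ∀ a → decodeℤ (encodedSuc a) ≡ decodeℤ a ℤ.+ ℤ.1ℤ
decodeℤ-encodedSuc a = begin
  decodeℤ (encodedSuc a)                      ≡⟨ cong (decodeℤ ∘ encodedSuc) (sym (encodeℤ-decodeℤ a)) ⟩
  decodeℤ (encodedSuc (encodeℤ (decodeℤ a)))  ≡⟨ cong decodeℤ (encodedSuc-encodeℤ (decodeℤ a)) ⟩
  decodeℤ (encodeℤ (decodeℤ a ℤ.+ ℤ.1ℤ))      ≡⟨ decodeℤ-encodeℤ _ ⟩
  decodeℤ a ℤ.+ ℤ.1ℤ                          ∎
  where open ≡-Reasoning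

encodedSucᶜ : ∀ {n} → Computation n → Computation n
encodedSucᶜ = lift₁ (ifzᶜ parityᶜ (a +ᶜ const 2) (ifzᶜ (a ∸ᶜ const 1) (const 0) (a ∸ᶜ const 2)))
  where
  a : Computation 1
  a = var (# 0)
  parityᶜ : Computation 1
  parityᶜ = lift₁ (primRec (λ k _ → parity k) (const 0) (ifzᶜ (var (# 1)) (const 1) (const 0))
                           (λ _ → refl) (λ _ _ → refl)) a

decodeTile : ℕ → Tile
decodeTile c = ⟨ unpair₁ c , unpair₁ (unpair₂ c) , unpair₁ (unpair₂ (unpair₂ c)) , unpair₂ (unpair₂ (unpair₂ c)) ⟩

tileCode-decodeTile : ∀ c → tileCode (decodeTile c) ≡ c
tileCode-decodeTile c = begin
  pair (unpair₁ c) (pair (unpair₁ (unpair₂ c)) (pair (unpair₁ (unpair₂ (unpair₂ c))) (unpair₂ (unpair₂ (unpair₂ c)))))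
    ≡⟨ cong (λ m → pair (unpair₁ c) (pair (unpair₁ (unpair₂ c)) m)) (pair-unpair (unpair₂ (unpair₂ c))) ⟩
  pair (unpair₁ c) (pair (unpair₁ (unpair₂ c)) (unpair₂ (unpair₂ c)))
    ≡⟨ cong (pair (unpair₁ c)) (pair-unpair (unpair₂ c)) ⟩
  pair (unpair₁ c) (unpair₂ c)
    ≡⟨ pair-unpair c ⟩
  c ∎
  where open ≡-Reasoning

decodeTile-tileCode : ∀ t → decodeTile (tileCode t) ≡ t
decodeTile-tileCode ⟨ l , u , r , b ⟩
  rewrite unpair-pair l (pair u (pair r b)) | unpair-pair u (pair r b) | unpair-pair r b = refl

leftᶜ upᶜ rightᶜ bottomᶜ : ∀ {n} → Computation n → Computation n
leftᶜ   c = unpair₁ᶜ c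
upᶜ     c = unpair₁ᶜ (unpair₂ᶜ c)
rightᶜ  c = unpair₁ᶜ (unpair₂ᶜ (unpair₂ᶜ c))
bottomᶜ c = unpair₂ᶜ (unpair₂ᶜ (unpair₂ᶜ c))

cell : ℤ → ℤ → ℕ
cell X Y = pair (encodeℤ X) (encodeℤ Y)

cellX cellY : ℕ → ℤ
cellX i = decodeℤ (unpair₁ i)
cellY i = decodeℤ (unpair₂ i)

rightOf upOf : ℕ → ℕ
rightOf i = pair (encodedSuc (unpair₁ i)) (unpair₂ i)
upOf    i = pair (unpair₁ i) (encodedSuc (unpair₂ i))

rightOfᶜ upOfᶜ : ∀ {n} → Computation n → Computation n
rightOfᶜ i = pairᶜ (encodedSucᶜ (unpair₁ᶜ i)) (unpair₂ᶜ i)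
upOfᶜ    i = pairᶜ (unpair₁ᶜ i) (encodedSucᶜ (unpair₂ᶜ i))

rightOf-cell : ∀ X Y → rightOf (cell X Y) ≡ cell (X ℤ.+ ℤ.1ℤ) Y
rightOf-cell X Y rewrite unpair-pair (encodeℤ X) (encodeℤ Y) = cong (λ a → pair a (encodeℤ Y)) (encodedSuc-encodeℤ X)

upOf-cell : ∀ X Y → upOf (cell X Y) ≡ cell X (Y ℤ.+ ℤ.1ℤ)
upOf-cell X Y rewrite unpair-pair (encodeℤ X) (encodeℤ Y) = cong (pair (encodeℤ X)) (encodedSuc-encodeℤ Y)

cellX-rightOf : ∀ i → cellX (rightOf i) ≡ cellX i ℤ.+ ℤ.1ℤ
cellX-rightOf i rewrite unpair-pair (encodedSuc (unpair₁ i)) (unpair₂ i) = decodeℤ-encodedSuc (unpair₁ i)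

cellY-rightOf : ∀ i → cellY (rightOf i) ≡ cellY i
cellY-rightOf i = cong decodeℤ (unpair₂-pair (encodedSuc (unpair₁ i)) (unpair₂ i))

cellX-upOf : ∀ i → cellX (upOf i) ≡ cellX i
cellX-upOf i = cong decodeℤ (unpair₁-pair (unpair₁ i) (encodedSuc (unpair₂ i)))

cellY-upOf : ∀ i → cellY (upOf i) ≡ cellY i ℤ.+ ℤ.1ℤ
cellY-upOf i rewrite unpair-pair (unpair₁ i) (encodedSuc (unpair₂ i)) = decodeℤ-encodedSuc (unpair₂ i)

-- Entry i pairs the tile on cell i with a witness i ≤ w ∈ Ts; the witnesses along an infinite
-- path make Ts infinite.
record ConsistentAt (Ts : ℕ → Set) (entry : ℕ → ℕ) (n i : ℕ) : Set where
  tileAt : ℕ → Tile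
  tileAt j = decodeTile (unpair₁ (entry j))
  field
    tile∈Ts      : Ts (unpair₁ (entry i))
    witness∈Ts   : Ts (unpair₂ (entry i))
    i≤witness    : i ≤ unpair₂ (entry i)
    matchesRight : rightOf i < n → right (tileAt i) ≡ left (tileAt (rightOf i))
    matchesUp    : upOf i < n → up (tileAt i) ≡ bottom (tileAt (upOf i))

PartialTiling : (ℕ → Set) → (ℕ → ℕ) → ℕ → Set
PartialTiling Ts entry n = ∀ i → i < n → ConsistentAt Ts entry n i

PartialTiling-mono : ∀ {Ts entry m n} → m ≤ n → PartialTiling Ts entry n → PartialTiling Ts entry m
PartialTiling-mono m≤n tiling i i<m = record
  { tile∈Ts = tile∈Ts ; witness∈Ts = witness∈Ts ; i≤witness = i≤witness
  ; matchesRight = λ r<m → matchesRight (<-≤-trans r<m m≤n)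
  ; matchesUp    = λ u<m → matchesUp (<-≤-trans u<m m≤n) }
  where open ConsistentAt (tiling i (<-≤-trans i<m m≤n))

PartialTiling-cong : ∀ {Ts entry entry′ n} → (∀ i → i < n → entry i ≡ entry′ i) →
                     PartialTiling Ts entry n → PartialTiling Ts entry′ n
PartialTiling-cong {Ts} {n = n} same tiling i i<n = record
  { tile∈Ts = subst (Ts ∘ unpair₁) (same i i<n) tile∈Ts
  ; witness∈Ts = subst (Ts ∘ unpair₂) (same i i<n) witness∈Ts
  ; i≤witness = subst (λ c → i ≤ unpair₂ c) (same i i<n) i≤witness
  ; matchesRight = λ r<n → subst₂ (λ c d → right (decodeTile (unpair₁ c)) ≡ left (decodeTile (unpair₁ d)))
                                  (same i i<n) (same (rightOf i) r<n) (matchesRight r<n)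
  ; matchesUp = λ u<n → subst₂ (λ c d → up (decodeTile (unpair₁ c)) ≡ bottom (decodeTile (unpair₁ d)))
                               (same i i<n) (same (upOf i) u<n) (matchesUp u<n) }
  where open ConsistentAt (tiling i i<n)

consistentᶜ : Computation 3
consistentᶜ =
  dropᶜ i x ⇒ᶜ listedᶜ x v t ≡ᶜ const 1 ∧ᶜ listedᶜ x v w ≡ᶜ const 1 ∧ᶜ i ≤ᶜ w
             ∧ᶜ (dropᶜ (rightOfᶜ i) x ⇒ᶜ rightᶜ t ≡ᶜ leftᶜ (unpair₁ᶜ (x !ᶜ rightOfᶜ i)))
             ∧ᶜ (dropᶜ (upOfᶜ i) x ⇒ᶜ upᶜ t ≡ᶜ bottomᶜ (unpair₁ᶜ (x !ᶜ upOfᶜ i)))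
  where
  i x v t w : Computation 3
  i = var (# 0)
  x = var (# 1)
  v = var (# 2)
  t = unpair₁ᶜ (x !ᶜ i)
  w = unpair₂ᶜ (x !ᶜ i)

consistent-decides : ∀ {e v} s i → Listing e (strCode s) v →
  fun consistentᶜ (i ∷ strCode s ∷ v ∷ []) decides (i < L.length s → ConsistentAt (InSet e) (s !_) (L.length s) i)
consistent-decides {e} {v} s i listing
  rewrite !ⁿ-strCode s i | !ⁿ-strCode s (rightOf i) | !ⁿ-strCode s (upOf i) =
  ⇒ⁿ-decides (dropⁿ-decides i s) λ i<n →
    decides-⇔ (∧ⁿ-decides (listed-decides listing (≤-trans (unpair₁≤ (s ! i)) (<⇒≤ (!<strCode s i i<n))))
              (∧ⁿ-decides (listed-decides listing (≤-trans (unpair₂≤ (s ! i)) (<⇒≤ (!<strCode s i i<n))))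
              (∧ⁿ-decides (≤ⁿ-decides i (unpair₂ (s ! i)))
              (∧ⁿ-decides (⇒ⁿ-decides (dropⁿ-decides (rightOf i) s) (λ _ → ≡ⁿ-decides _ _))
                          (⇒ⁿ-decides (dropⁿ-decides (upOf i) s) (λ _ → ≡ⁿ-decides _ _))))))
      ( (λ (t∈ , w∈ , i≤w , r , u) → record { tile∈Ts = t∈ ; witness∈Ts = w∈ ; i≤witness = i≤w
                                             ; matchesRight = r ; matchesUp = u })
      , λ c → let open ConsistentAt c in tile∈Ts , witness∈Ts , i≤witness , matchesRight , matchesUp )

TilingNode : (ℕ → Set) → List ℕ → Set
TilingNode Ts s = PartialTiling Ts (s !_) (L.length s)

TilingNode-++⁻ˡ : ∀ {Ts} s t → TilingNode Ts (s ++ t) → TilingNode Ts s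
TilingNode-++⁻ˡ s t node =
  PartialTiling-cong (λ i i<n → !-++ˡ s t i i<n)
    (PartialTiling-mono (subst (L.length s ≤_) (sym (length-++ s)) (m≤m+n _ _)) node)

TilingNode-path : ∀ {Ts} p n → TilingNode Ts (L.map p (L.upTo n)) ⇔ PartialTiling Ts p n
TilingNode-path {Ts} p n =
  (λ node → PartialTiling-cong (λ i i<n → !-mapUpTo p n i i<n)
                                (subst (PartialTiling Ts (path !_)) (length-mapUpTo p n) node)) ,
  (λ tiling → subst (PartialTiling Ts (path !_)) (sym (length-mapUpTo p n))
                    (PartialTiling-cong (λ i i<n → sym (!-mapUpTo p n i i<n)) tiling))
  where
  path : List ℕ
  path = L.map p (L.upTo n)

tiling⇒partialTilings : ∀ {Ts} → Tiling (Ts ∘ tileCode) → Infinite Ts →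
                        Σ (ℕ → ℕ) λ p → ∀ n → PartialTiling Ts p n
tiling⇒partialTilings {Ts} (f , f∈Ts , matchRight , matchUp) infinite = p , λ n i _ → consistent n i
  where
  tileOf : ℕ → Tile
  tileOf i = f (cellX i) (cellY i)
  witness : ℕ → ℕ
  witness i = proj₁ (infinite i)
  p : ℕ → ℕ
  p i = pair (tileCode (tileOf i)) (witness i)
  tileAt-p : ∀ i → decodeTile (unpair₁ (p i)) ≡ tileOf i
  tileAt-p i = trans (cong decodeTile (unpair₁-pair (tileCode (tileOf i)) (witness i))) (decodeTile-tileCode (tileOf i))
  tileOf-rightOf : ∀ i → tileOf (rightOf i) ≡ f (cellX i ℤ.+ ℤ.1ℤ) (cellY i)
  tileOf-rightOf i = cong₂ f (cellX-rightOf i) (cellY-rightOf i)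
  tileOf-upOf : ∀ i → tileOf (upOf i) ≡ f (cellX i) (cellY i ℤ.+ ℤ.1ℤ)
  tileOf-upOf i = cong₂ f (cellX-upOf i) (cellY-upOf i)
  open ≡-Reasoning
  consistent : ∀ n i → ConsistentAt Ts p n i
  consistent n i = record
    { tile∈Ts    = subst Ts (sym (unpair₁-pair (tileCode (tileOf i)) (witness i))) (f∈Ts (cellX i) (cellY i))
    ; witness∈Ts = subst Ts (sym (unpair₂-pair (tileCode (tileOf i)) (witness i))) (proj₂ (proj₂ (infinite i)))
    ; i≤witness  = subst (i ≤_) (sym (unpair₂-pair (tileCode (tileOf i)) (witness i))) (proj₁ (proj₂ (infinite i)))
    ; matchesRight = λ _ → begin
        right (decodeTile (unpair₁ (p i)))           ≡⟨ cong right (tileAt-p i) ⟩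
        right (tileOf i)                             ≡⟨ matchRight (cellX i) (cellY i) ⟩
        left (f (cellX i ℤ.+ ℤ.1ℤ) (cellY i))        ≡⟨ cong left (sym (tileOf-rightOf i)) ⟩
        left (tileOf (rightOf i))                    ≡⟨ cong left (sym (tileAt-p (rightOf i))) ⟩
        left (decodeTile (unpair₁ (p (rightOf i))))  ∎
    ; matchesUp = λ _ → begin
        up (decodeTile (unpair₁ (p i)))              ≡⟨ cong up (tileAt-p i) ⟩
        up (tileOf i)                                ≡⟨ matchUp (cellX i) (cellY i) ⟩
        bottom (f (cellX i) (cellY i ℤ.+ ℤ.1ℤ))      ≡⟨ cong bottom (sym (tileOf-upOf i)) ⟩
        bottom (tileOf (upOf i))                     ≡⟨ cong bottom (sym (tileAt-p (upOf i))) ⟩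
        bottom (decodeTile (unpair₁ (p (upOf i))))   ∎
    }

partialTilings⇒tiling : ∀ {Ts} p → (∀ n → PartialTiling Ts p n) → Tiling (Ts ∘ tileCode) × Infinite Ts
partialTilings⇒tiling {Ts} p tilings = (f , f∈Ts , matchRight , matchUp) , infinite
  where
  consistent : ∀ i j → ConsistentAt Ts p (suc (i + j)) i
  consistent i j = tilings (suc (i + j)) i (s≤s (m≤m+n i j))
  f : ℤ → ℤ → Tile
  f X Y = decodeTile (unpair₁ (p (cell X Y)))
  f∈Ts : ∀ X Y → Ts (tileCode (f X Y))
  f∈Ts X Y = subst Ts (sym (tileCode-decodeTile _)) (ConsistentAt.tile∈Ts (consistent (cell X Y) 0))
  matchRight : ∀ X Y → right (f X Y) ≡ left (f (X ℤ.+ ℤ.1ℤ) Y)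
  matchRight X Y = subst (λ j → right (f X Y) ≡ left (decodeTile (unpair₁ (p j)))) (rightOf-cell X Y)
    (ConsistentAt.matchesRight (consistent (cell X Y) (rightOf (cell X Y)))
                               (s≤s (m≤n+m (rightOf (cell X Y)) (cell X Y))))
  matchUp : ∀ X Y → up (f X Y) ≡ bottom (f X (Y ℤ.+ ℤ.1ℤ))
  matchUp X Y = subst (λ j → up (f X Y) ≡ bottom (decodeTile (unpair₁ (p j)))) (upOf-cell X Y)
    (ConsistentAt.matchesUp (consistent (cell X Y) (upOf (cell X Y)))
                            (s≤s (m≤n+m (upOf (cell X Y)) (cell X Y))))
  infinite : Infinite Ts
  infinite n = unpair₂ (p n) , ConsistentAt.i≤witness (consistent n 0) , ConsistentAt.witness∈Ts (consistent n 0)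

tilingNodeᶜ : Computation 2
tilingNodeᶜ = lift₃ (allBelowᶜ consistentᶜ) inputᶜ inputᶜ listingᶜ

tilingNode-decides : ∀ {e x v} → Listing e x v → fun tilingNodeᶜ (x ∷ v ∷ []) decides TilingNode (InSet e) (decodeStr x)
tilingNode-decides {e} {x} {v} listing with decodeStr x | strCode-decodeStr x
... | s | refl = decides-⇔ (allBelow-decides _ (strCode s) (λ i _ → consistent-decides s i listing))
  ( (λ consistent i i<n → consistent i (<-≤-trans i<n (length≤strCode s)) i<n)
  , (λ node i _ i<n → node i i<n) )

tilingReduction : ℕ → ℕ
tilingReduction = guardedReduction booleanGuardᶜ tilingNodeᶜ

module _ (e : ℕ) where

  open GuardedReduction booleanGuardᶜ tilingNodeᶜ {e} booleanGuard-decides tilingNode-decides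

  private
    tilingNode⁻ : ∀ {s} → InSet (tilingReduction e) (strCode s) → TilingNode (InSet e) s
    tilingNode⁻ {s} s∈ = subst (TilingNode (InSet e)) (decodeStr-strCode s) (guardedReduction-inSet⁻ s∈)

  tilingReduction-preserves : TILE e → ILL (tilingReduction e)
  tilingReduction-preserves (isChar , infinite , tiling) = guardedReduction-isCharFn isChar isChar , isTree , (p , path)
    where
    inSet : ∀ {s} → TilingNode (InSet e) s → InSet (tilingReduction e) (strCode s)
    inSet {s} node =
      guardedReduction-inSet isChar isChar (subst (TilingNode (InSet e)) (sym (decodeStr-strCode s)) node)
    isTree : IsTree (λ s → InSet (tilingReduction e) (strCode s))
    isTree s t s++t∈ = inSet (TilingNode-++⁻ˡ s t (tilingNode⁻ s++t∈))
    partial : Σ (ℕ → ℕ) λ p → ∀ n → PartialTiling (InSet e) p n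
    partial = tiling⇒partialTilings tiling infinite
    p : ℕ → ℕ
    p = proj₁ partial
    path : ∀ n → InSet (tilingReduction e) (strCode (L.map p (L.upTo n)))
    path n = inSet (proj₂ (TilingNode-path p n) (proj₂ partial n))

  tilingReduction-reflects : ILL (tilingReduction e) → TILE e
  tilingReduction-reflects (isChar′ , _ , (p , path)) = guardedReduction-isCharFn⁻ isChar′ , proj₂ tiling , proj₁ tiling
    where
    tiling : Tiling (λ t → InSet e (tileCode t)) × Infinite (InSet e)
    tiling = partialTilings⇒tiling p (λ n → proj₁ (TilingNode-path p n) (tilingNode⁻ (path n)))

TILE≤ILL : TILE ≤m ILL
TILE≤ILL = tilingReduction , reduction-computable _ , λ e → tilingReduction-preserves e , tilingReduction-reflects e

-- σ extends τ by one entry, as far as can be seen below the bound B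
SnocBelow : ℕ → List ℕ → List ℕ → Set
SnocBelow B σ τ = 0 < L.length σ ×
  (∀ i → i < B → ((i < L.length τ) ⇔ (suc i < L.length σ)) × (i < L.length τ → τ ! i ≡ σ ! i))

SnocBelow-∷ʳ : ∀ B τ a → SnocBelow B (τ ∷ʳ a) τ
SnocBelow-∷ʳ B τ a = subst (0 <_) (sym (length-∷ʳ τ a)) (s≤s z≤n) , λ i _ →
  ( (λ i<n → subst (suc i <_) (sym (length-∷ʳ τ a)) (s≤s i<n))
  , (λ i<n → N.s≤s⁻¹ (subst (suc i <_) (length-∷ʳ τ a) i<n)) ) ,
  λ i<n → sym (!-++ˡ τ (a ∷ []) i i<n)

counts-one-more : ∀ {B m n} → m ≤ B → n ≤ B → 0 < m → (∀ i → i < B → (i < n) ⇔ (suc i < m)) → m ≡ suc n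
counts-one-more {B} {suc m} {n} 1+m≤B n≤B _ agree with <-cmp m n
... | tri≈ _ m≡n _ = cong suc m≡n
... | tri< m<n _ _ = ⊥-elim (<-irrefl refl (proj₁ (agree m (<-≤-trans m<n n≤B)) m<n))
... | tri> _ _ n<m = ⊥-elim (<-irrefl refl (proj₂ (agree n (<-≤-trans n<m (<⇒≤ 1+m≤B))) (s≤s n<m)))

SnocBelow⇒∷ʳ : ∀ B σ τ → L.length σ ≤ B → L.length τ ≤ B → SnocBelow B σ τ → Σ ℕ λ a → σ ≡ τ ∷ʳ a
SnocBelow⇒∷ʳ B σ τ σ≤B τ≤B (0<σ , below) =
  entrywise σ τ (counts-one-more σ≤B τ≤B 0<σ (λ i i<B → proj₁ (below i i<B)))
                (λ i i<τ → proj₂ (below i (<-≤-trans i<τ τ≤B)) i<τ)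
  where
  entrywise : ∀ σ τ → L.length σ ≡ suc (L.length τ) → (∀ i → i < L.length τ → τ ! i ≡ σ ! i) → Σ ℕ λ a → σ ≡ τ ∷ʳ a
  entrywise (a ∷ [])    []      _  _    = a , refl
  entrywise (b ∷ σ)     (c ∷ τ) eq same with entrywise σ τ (suc-injective eq) (λ i i<n → same (suc i) (s≤s i<n))
  ... | a , σ≡ = a , cong₂ _∷_ (sym (same 0 (s≤s z≤n))) σ≡

SnocCode : ℕ → ℕ → Set
SnocCode c d = Σ (List ℕ) λ τ → Σ ℕ λ a → c ≡ strCode (τ ∷ʳ a) × d ≡ strCode τ

-- c ∧ⁿ … checks that c codes a non-empty string
isSnocⁿ : ℕ → ℕ → ℕ
isSnocⁿ c d = c ∧ⁿ allBelow (λ i → (dropⁿ i d ⇔ⁿ dropⁿ (suc i) c) ∧ⁿ (dropⁿ i d ⇒ⁿ d !ⁿ i ≡ⁿ c !ⁿ i)) (c + d)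

isSnocᶜ : ∀ {n} → Computation n → Computation n → Computation n
isSnocᶜ = lift₂ (c ∧ᶜ lift₃ (allBelowᶜ entryᶜ) (c +ᶜ d) c d)
  where
  c d : Computation 2
  c = var (# 0)
  d = var (# 1)
  entryᶜ : Computation 3
  entryᶜ = (dropᶜ i d′ ⇔ᶜ dropᶜ (sucᶜ i) c′) ∧ᶜ (dropᶜ i d′ ⇒ᶜ d′ !ᶜ i ≡ᶜ c′ !ᶜ i)
    where
    i c′ d′ : Computation 3
    i  = var (# 0)
    c′ = var (# 1)
    d′ = var (# 2)

isSnoc-decides : ∀ c d → isSnocⁿ c d decides SnocCode c d
isSnoc-decides c d with decodeStr c | strCode-decodeStr c | decodeStr d | strCode-decodeStr d
... | σ | refl | τ | refl = decides-⇔
  (∧ⁿ-decides (dropⁿ-decides 0 σ) (allBelow-decides _ (strCode σ + strCode τ) λ i _ →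
    ∧ⁿ-decides (⇔ⁿ-decides (dropⁿ-decides i τ) (dropⁿ-decides (suc i) σ))
               (⇒ⁿ-decides (dropⁿ-decides i τ) λ _ →
                  decides-⇔ (≡ⁿ-decides _ _) (entries (!ⁿ-strCode τ i) (!ⁿ-strCode σ i)))))
  ( (λ below → let (a , σ≡) = SnocBelow⇒∷ʳ B σ τ σ≤B τ≤B below in τ , a , cong strCode σ≡ , refl)
  , λ (τ′ , a , σ≡ , τ≡) → subst₂ (SnocBelow B) (sym (strCode-injective σ≡)) (sym (strCode-injective τ≡))
                                  (SnocBelow-∷ʳ B τ′ a) )
  where
  B : ℕ
  B = strCode σ + strCode τ
  σ≤B : L.length σ ≤ B
  σ≤B = ≤-trans (length≤strCode σ) (m≤m+n (strCode σ) (strCode τ))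
  τ≤B : L.length τ ≤ B
  τ≤B = ≤-trans (length≤strCode τ) (m≤n+m (strCode τ) (strCode σ))
  entries : ∀ {a b a′ b′ : ℕ} → a ≡ a′ → b ≡ b′ → (a ≡ b) ⇔ (a′ ≡ b′)
  entries refl refl = (λ eq → eq) , (λ eq → eq)

⇓ ⇑ : List ℕ → ℕ
⇓ σ = pair 0 (strCode σ)
⇑ σ = pair 1 (strCode σ)

⇓≢⇑ : ∀ σ τ → ⇓ σ ≢ ⇑ τ
⇓≢⇑ σ τ eq with proj₁ (pair-injective {0} {strCode σ} {1} {strCode τ} eq)
... | ()

⇓-injective : ∀ σ τ → ⇓ σ ≡ ⇓ τ → σ ≡ τ
⇓-injective σ τ eq = strCode-injective (proj₂ (pair-injective {0} {strCode σ} {0} {strCode τ} eq))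

⇑-injective : ∀ σ τ → ⇑ σ ≡ ⇑ τ → σ ≡ τ
⇑-injective σ τ eq = strCode-injective (proj₂ (pair-injective {1} {strCode σ} {1} {strCode τ} eq))

-- A column reads, from bottom to top, ⇓ σ₀ , ⇓ σ₁ , … , ⇓ [] , ⇑ [] , ⇑ τ₁ , ⇑ τ₂ , …, where each σ
-- drops the last entry of the one below it and the τ grow along a branch of T.
data ColumnStep (T : List ℕ → Set) (b u : ℕ) : Set where
  shrink : ∀ τ a → b ≡ ⇓ (τ ∷ʳ a) → u ≡ ⇓ τ → ColumnStep T b u
  turn   : b ≡ ⇓ [] → u ≡ ⇑ [] → ColumnStep T b u
  grow   : ∀ τ a → T τ → T (τ ∷ʳ a) → b ≡ ⇑ τ → u ≡ ⇑ (τ ∷ʳ a) → ColumnStep T b u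

Shrinks Turns : ℕ → ℕ → Set
Shrinks b u = Σ (List ℕ) λ τ → Σ ℕ λ a → b ≡ ⇓ (τ ∷ʳ a) × u ≡ ⇓ τ
Turns   b u = b ≡ ⇓ [] × u ≡ ⇑ []

Grows : (List ℕ → Set) → ℕ → ℕ → Set
Grows T b u = Σ (List ℕ) λ τ → Σ ℕ λ a → T τ × T (τ ∷ʳ a) × b ≡ ⇑ τ × u ≡ ⇑ (τ ∷ʳ a)

ColumnStep-cases : ∀ {T b u} → (Shrinks b u ⊎ Turns b u ⊎ Grows T b u) ⇔ ColumnStep T b u
ColumnStep-cases = to , from
  where
  to : ∀ {T b u} → Shrinks b u ⊎ Turns b u ⊎ Grows T b u → ColumnStep T b u
  to (inj₁ (τ , a , b≡ , u≡))                  = shrink τ a b≡ u≡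
  to (inj₂ (inj₁ (b≡ , u≡)))                   = turn b≡ u≡
  to (inj₂ (inj₂ (τ , a , Tτ , Tτa , b≡ , u≡))) = grow τ a Tτ Tτa b≡ u≡
  from : ∀ {T b u} → ColumnStep T b u → Shrinks b u ⊎ Turns b u ⊎ Grows T b u
  from (shrink τ a b≡ u≡)        = inj₁ (τ , a , b≡ , u≡)
  from (turn b≡ u≡)              = inj₂ (inj₁ (b≡ , u≡))
  from (grow τ a Tτ Tτa b≡ u≡)   = inj₂ (inj₂ (τ , a , Tτ , Tτa , b≡ , u≡))

ColumnTile : (List ℕ → Set) → Tile → Set
ColumnTile T t = left t ≡ 0 × right t ≡ 0 × ColumnStep T (bottom t) (up t)

module BranchOfColumn {T : List ℕ → Set} (β υ : ℤ → ℕ) (stacked : ∀ Y → υ Y ≡ β (Y ℤ.+ ℤ.1ℤ))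
              (step : ∀ Y → ColumnStep T (β Y) (υ Y)) where

  Turn : Set
  Turn = Σ ℤ λ Y → υ Y ≡ ⇑ []

  private
    shorter : ∀ τ a {n} → L.length (τ ∷ʳ a) ≡ suc n → L.length τ ≡ n
    shorter τ a eq = suc-injective (trans (sym (length-∷ʳ τ a)) eq)

    pred+1 : ∀ Y → (Y ℤ.+ -[1+ 0 ]) ℤ.+ ℤ.1ℤ ≡ Y
    pred+1 Y = trans (ℤ.+-assoc Y -[1+ 0 ] ℤ.1ℤ) (ℤ.+-identityʳ Y)

  turnAbove : ∀ n σ Y → L.length σ ≡ n → υ Y ≡ ⇓ σ → Turn
  turnAbove n σ Y len υ≡ with step (Y ℤ.+ ℤ.1ℤ)
  ... | turn _ υ′≡ = Y ℤ.+ ℤ.1ℤ , υ′≡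
  ... | grow τ _ _ _ β≡ _ = ⊥-elim (⇓≢⇑ σ τ (trans (sym υ≡) (trans (stacked Y) β≡)))
  ... | shrink τ a β≡ υ′≡ with ⇓-injective σ (τ ∷ʳ a) (trans (sym υ≡) (trans (stacked Y) β≡)) | n
  ...   | refl | zero  = ⊥-elim (0≢1+n (trans (sym len) (length-∷ʳ τ a)))
  ...   | refl | suc m = turnAbove m τ (Y ℤ.+ ℤ.1ℤ) (shorter τ a len) υ′≡

  turnBelow : ∀ n σ Y → L.length σ ≡ n → υ Y ≡ ⇑ σ → Turn
  turnBelow n σ Y len υ≡ with step Y
  ... | turn _ υ≡′ = Y , υ≡′
  ... | shrink τ _ _ υ≡′ = ⊥-elim (⇓≢⇑ τ σ (trans (sym υ≡′) υ≡))
  ... | grow τ a _ _ β≡ υ≡′ with ⇑-injective σ (τ ∷ʳ a) (trans (sym υ≡) υ≡′) | n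
  ...   | refl | zero  = ⊥-elim (0≢1+n (trans (sym len) (length-∷ʳ τ a)))
  ...   | refl | suc m = turnBelow m τ (Y ℤ.+ -[1+ 0 ])  (shorter τ a len)
                           (trans (stacked _) (trans (cong β (pred+1 Y)) β≡))

  turnSomewhere : Turn
  turnSomewhere with step (+ 0)
  ... | turn _ υ≡ = + 0 , υ≡
  ... | shrink τ a _ υ≡ = turnAbove _ τ (+ 0) refl υ≡
  ... | grow τ a _ _ _ υ≡ = turnBelow _ (τ ∷ʳ a) (+ 0) refl υ≡

  growsAbove : ∀ σ Y → υ Y ≡ ⇑ σ → Σ ℕ λ a → υ (Y ℤ.+ ℤ.1ℤ) ≡ ⇑ (σ ∷ʳ a) × T σ × T (σ ∷ʳ a)
  growsAbove σ Y υ≡ with step (Y ℤ.+ ℤ.1ℤ)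
  ... | shrink τ a β≡ _ = ⊥-elim (⇓≢⇑ (τ ∷ʳ a) σ (trans (sym β≡) (trans (sym (stacked Y)) υ≡)))
  ... | turn β≡ _ = ⊥-elim (⇓≢⇑ [] σ (trans (sym β≡) (trans (sym (stacked Y)) υ≡)))
  ... | grow τ a Tτ Tτa β≡ υ′≡ with ⇑-injective σ τ (trans (sym υ≡) (trans (stacked Y) β≡))
  ...   | refl = a , υ′≡ , Tτ , Tτa

  illFounded : IllFounded T
  illFounded = p , λ n → subst T (sym (prefix-branch n)) (T-branch n)
    where
    Y₀ : ℤ
    Y₀ = proj₁ turnSomewhere
    branch : ∀ k → Σ (List ℕ) λ σ → υ (Y₀ ℤ.+ + k) ≡ ⇑ σ
    next : ∀ k → Σ ℕ λ a → υ ((Y₀ ℤ.+ + k) ℤ.+ ℤ.1ℤ) ≡ ⇑ (proj₁ (branch k) ∷ʳ a)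
                         × T (proj₁ (branch k)) × T (proj₁ (branch k) ∷ʳ a)
    next k = growsAbove (proj₁ (branch k)) (Y₀ ℤ.+ + k) (proj₂ (branch k))
    branch zero    = [] , trans (cong υ (ℤ.+-identityʳ Y₀)) (proj₂ turnSomewhere)
    branch (suc k) = proj₁ (branch k) ∷ʳ proj₁ (next k) ,
      trans (cong υ (sym (trans (ℤ.+-assoc Y₀ (+ k) ℤ.1ℤ) (cong (λ m → Y₀ ℤ.+ + m) (+-comm k 1)))))
            (proj₁ (proj₂ (next k)))
    p : ℕ → ℕ
    p k = proj₁ (next k)
    prefix-branch : ∀ n → L.map p (L.upTo n) ≡ proj₁ (branch n)
    prefix-branch zero    = refl
    prefix-branch (suc n) = trans (mapUpTo-suc p n) (cong (_∷ʳ p n) (prefix-branch n))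
    T-branch : ∀ n → T (proj₁ (branch n))
    T-branch zero    = proj₁ (proj₂ (proj₂ (next 0)))
    T-branch (suc k) = proj₂ (proj₂ (proj₂ (next k)))

module ColumnOfBranch (p : ℕ → ℕ) where

  branch : ℕ → List ℕ
  branch k = L.map p (L.upTo k)

  column : ℤ → Tile
  column (+ zero)  = ⟨ 0 , ⇑ [] , 0 , ⇓ [] ⟩
  column (+ suc k) = ⟨ 0 , ⇑ (branch (suc k)) , 0 , ⇑ (branch k) ⟩
  column -[1+ k ]  = ⟨ 0 , ⇓ (branch k) , 0 , ⇓ (branch (suc k)) ⟩

  column-stacked : ∀ Y → up (column Y) ≡ bottom (column (Y ℤ.+ ℤ.1ℤ))
  column-stacked (+ zero)       = refl
  column-stacked (+ suc k)      = cong (λ m → ⇑ (branch m)) (+-comm 1 k)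
  column-stacked -[1+ zero ]    = refl
  column-stacked -[1+ suc k ]   = refl

  column-tile : ∀ {T : List ℕ → Set} → (∀ n → T (branch n)) → ∀ Y → ColumnTile T (column Y)
  column-tile Tbranch (+ zero)  = refl , refl , turn refl refl
  column-tile {T} Tbranch (+ suc k) = refl , refl ,
    grow (branch k) (p k) (Tbranch k) (subst T (mapUpTo-suc p k) (Tbranch (suc k))) refl (cong ⇑ (mapUpTo-suc p k))
  column-tile Tbranch -[1+ k ]  = refl , refl , shrink (branch k) (p k) (cong ⇓ (mapUpTo-suc p k)) refl

  n≤column : ∀ n → n ≤ tileCode (column (+ suc n))
  n≤column n = begin
    n                                   ≤⟨ n≤1+n n ⟩
    suc n                               ≡⟨ sym (length-mapUpTo p (suc n)) ⟩
    L.length (branch (suc n))           ≤⟨ length≤strCode (branch (suc n)) ⟩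
    strCode (branch (suc n))            ≤⟨ n≤pair[m,n] 1 _ ⟩
    ⇑ (branch (suc n))                  ≤⟨ m≤pair[m,n] _ _ ⟩
    pair (⇑ (branch (suc n))) _         ≤⟨ n≤pair[m,n] 0 _ ⟩
    tileCode (column (+ suc n))         ∎
    where open ≤-Reasoning

unpair-⇔ : ∀ c a b → (unpair₁ c ≡ a × unpair₂ c ≡ b) ⇔ (c ≡ pair a b)
unpair-⇔ c a b = (λ (eq₁ , eq₂) → pair-surjective c eq₁ eq₂) , λ { refl → unpair₁-pair a b , unpair₂-pair a b }

up≤ : ∀ c → up (decodeTile c) ≤ c
up≤ c = ≤-trans (unpair₁≤ (unpair₂ c)) (unpair₂≤ c)

bottom≤ : ∀ c → bottom (decodeTile c) ≤ c
bottom≤ c = ≤-trans (unpair₂≤ (unpair₂ (unpair₂ c))) (≤-trans (unpair₂≤ (unpair₂ c)) (unpair₂≤ c))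

shrinkᶜ turnᶜ growᶜ columnTileᶜ : Computation 2
shrinkᶜ = unpair₁ᶜ b ≡ᶜ const 0 ∧ᶜ unpair₁ᶜ u ≡ᶜ const 0 ∧ᶜ isSnocᶜ (unpair₂ᶜ b) (unpair₂ᶜ u)
  where b u : Computation 2
        b = bottomᶜ inputᶜ
        u = upᶜ inputᶜ
turnᶜ = bottomᶜ inputᶜ ≡ᶜ const 0 ∧ᶜ upᶜ inputᶜ ≡ᶜ const 1
growᶜ = unpair₁ᶜ b ≡ᶜ const 1 ∧ᶜ unpair₁ᶜ u ≡ᶜ const 1 ∧ᶜ isSnocᶜ (unpair₂ᶜ u) (unpair₂ᶜ b)
      ∧ᶜ listedᶜ inputᶜ listingᶜ (unpair₂ᶜ b) ≡ᶜ const 1 ∧ᶜ listedᶜ inputᶜ listingᶜ (unpair₂ᶜ u) ≡ᶜ const 1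
  where b u : Computation 2
        b = bottomᶜ inputᶜ
        u = upᶜ inputᶜ
columnTileᶜ = leftᶜ inputᶜ ≡ᶜ const 0 ∧ᶜ rightᶜ inputᶜ ≡ᶜ const 0 ∧ᶜ (shrinkᶜ ∨ᶜ turnᶜ ∨ᶜ growᶜ)

Node : ℕ → List ℕ → Set
Node e σ = InSet e (strCode σ)

module _ {e x v : ℕ} (listing : Listing e x v) where

  private
    b u : ℕ
    b = bottom (decodeTile x)
    u = up (decodeTile x)

  shrink-decides : fun shrinkᶜ (x ∷ v ∷ []) decides Shrinks b u
  shrink-decides = decides-⇔ (∧ⁿ-decides (≡ⁿ-decides _ 0) (∧ⁿ-decides (≡ⁿ-decides _ 0) (isSnoc-decides _ _)))
    ( (λ (b₁ , u₁ , τ , a , b₂ , u₂) → τ , a , pair-surjective b b₁ b₂ , pair-surjective u u₁ u₂)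
    , λ (τ , a , b≡ , u≡) → let (b₁ , b₂) = proj₂ (unpair-⇔ b 0 _) b≡ ; (u₁ , u₂) = proj₂ (unpair-⇔ u 0 _) u≡
                            in b₁ , u₁ , τ , a , b₂ , u₂ )

  turn-decides : fun turnᶜ (x ∷ v ∷ []) decides Turns b u
  turn-decides = ∧ⁿ-decides (≡ⁿ-decides b 0) (≡ⁿ-decides u 1)

  grow-decides : fun growᶜ (x ∷ v ∷ []) decides Grows (Node e) b u
  grow-decides = decides-⇔
    (∧ⁿ-decides (≡ⁿ-decides _ 1) (∧ⁿ-decides (≡ⁿ-decides _ 1) (∧ⁿ-decides (isSnoc-decides _ _)
      (∧ⁿ-decides (listed-decides listing (≤-trans (unpair₂≤ b) (bottom≤ x)))
                  (listed-decides listing (≤-trans (unpair₂≤ u) (up≤ x)))))))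
    ( (λ (b₁ , u₁ , (τ , a , u₂ , b₂) , Tb , Tu) →
         τ , a , subst (InSet e) b₂ Tb , subst (InSet e) u₂ Tu , pair-surjective b b₁ b₂ , pair-surjective u u₁ u₂)
    , λ (τ , a , Tτ , Tτa , b≡ , u≡) →
         let (b₁ , b₂) = proj₂ (unpair-⇔ b 1 _) b≡ ; (u₁ , u₂) = proj₂ (unpair-⇔ u 1 _) u≡
         in b₁ , u₁ , (τ , a , u₂ , b₂) , subst (InSet e) (sym b₂) Tτ , subst (InSet e) (sym u₂) Tτa )

  columnTile-decides : fun columnTileᶜ (x ∷ v ∷ []) decides ColumnTile (Node e) (decodeTile x)
  columnTile-decides = decides-⇔
    (∧ⁿ-decides (≡ⁿ-decides _ 0) (∧ⁿ-decides (≡ⁿ-decides _ 0)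
      (∨ⁿ-decides shrink-decides (∨ⁿ-decides turn-decides grow-decides))))
    ( (λ (l≡ , r≡ , step) → l≡ , r≡ , proj₁ ColumnStep-cases step)
    , (λ (l≡ , r≡ , step) → l≡ , r≡ , proj₂ ColumnStep-cases step) )

ClosedAt : ℕ → ℕ → Set
ClosedAt e x = ∀ τ a → x ≡ strCode (τ ∷ʳ a) → InSet e x → Node e τ

closureᶜ treeGuardᶜ : Computation 2
closureᶜ = lift₃ (allBelowᶜ entryᶜ) (sucᶜ inputᶜ) inputᶜ listingᶜ
  where
  entryᶜ : Computation 3
  entryᶜ = isSnocᶜ x y ⇒ᶜ listedᶜ x v x ≡ᶜ const 1 ⇒ᶜ listedᶜ x v y ≡ᶜ const 1
    where y x v : Computation 3
          y = var (# 0)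
          x = var (# 1)
          v = var (# 2)
treeGuardᶜ = booleanGuardᶜ ∧ᶜ closureᶜ

closure-decides : ∀ {e x v} → Listing e x v → fun closureᶜ (x ∷ v ∷ []) decides ClosedAt e x
closure-decides {e} {x} listing = decides-⇔
  (allBelow-decides _ (suc x) λ y y<1+x →
    ⇒ⁿ-decides (isSnoc-decides x y) λ _ →
    ⇒ⁿ-decides (listed-decides listing ≤-refl) λ _ → listed-decides listing (N.s≤s⁻¹ y<1+x))
  ( (λ closed τ a x≡ x∈ → closed (strCode τ) (s≤s (<⇒≤ (subst (strCode τ <_) (sym x≡) (strCode-∷ʳ-> τ a))))
                                 (τ , a , x≡ , refl) x∈)
  , (λ closed y _ (τ , a , x≡ , y≡) x∈ → subst (InSet e) (sym y≡) (closed τ a x≡ x∈)) )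

treeGuard-decides : ∀ {e x v} → Listing e x v → fun treeGuardᶜ (x ∷ v ∷ []) decides (φ e x 0 ⊎ φ e x 1) × ClosedAt e x
treeGuard-decides listing = ∧ⁿ-decides (booleanGuard-decides listing) (closure-decides listing)

columnReduction : ℕ → ℕ
columnReduction = guardedReduction treeGuardᶜ columnTileᶜ

closed⇒IsTree : ∀ {T : List ℕ → Set} → (∀ τ a → T (τ ∷ʳ a) → T τ) → IsTree T
closed⇒IsTree {T} closed s []      Ts    = subst T (++-identityʳ s) Ts
closed⇒IsTree {T} closed s (a ∷ t) Tsat =
  closed s a (closed⇒IsTree closed (s ∷ʳ a) t (subst T (sym (++-assoc s (a ∷ []) t)) Tsat))

module _ (e : ℕ) where

  open GuardedReduction treeGuardᶜ columnTileᶜ {e} treeGuard-decides columnTile-decides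

  private
    columnTile⁻ : ∀ t → InSet (columnReduction e) (tileCode t) → ColumnTile (Node e) t
    columnTile⁻ t t∈ = subst (ColumnTile (Node e)) (decodeTile-tileCode t) (guardedReduction-inSet⁻ t∈)

  columnReduction-preserves : ILL e → TILE (columnReduction e)
  columnReduction-preserves (isChar , isTree , (p , path)) = guardedReduction-isCharFn isChar guard , infinite , tiling
    where
    open ColumnOfBranch p
    guard : ∀ x → (φ e x 0 ⊎ φ e x 1) × ClosedAt e x
    guard x = isChar x , λ τ a x≡ x∈ → isTree τ (a ∷ []) (subst (InSet e) x≡ x∈)
    inSet : ∀ t → ColumnTile (Node e) t → InSet (columnReduction e) (tileCode t)
    inSet t tile = guardedReduction-inSet isChar guard (subst (ColumnTile (Node e)) (sym (decodeTile-tileCode t)) tile)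
    infinite : Infinite (InSet (columnReduction e))
    infinite n = tileCode (column (+ suc n)) , n≤column n , inSet _ (column-tile {Node e} path (+ suc n))
    tiling : Tiling (λ t → InSet (columnReduction e) (tileCode t))
    tiling = (λ _ Y → column Y) , (λ _ Y → inSet _ (column-tile {Node e} path Y)) ,
             (λ _ Y → flat Y Y) , (λ _ → column-stacked)
      where
      flat : ∀ Y Y′ → right (column Y) ≡ left (column Y′)
      flat Y Y′ = trans (proj₁ (proj₂ (column-tile {Node e} path Y))) (sym (proj₁ (column-tile {Node e} path Y′)))

  columnReduction-reflects : TILE (columnReduction e) → ILL e
  columnReduction-reflects (isChar′ , _ , (f , f∈ , _ , stacked)) =
    (λ x → proj₁ (guard x)) ,
    closed⇒IsTree (λ τ a Tτa → proj₂ (guard (strCode (τ ∷ʳ a))) τ a refl Tτa) ,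
    illFounded
    where
    guard : ∀ x → (φ e x 0 ⊎ φ e x 1) × ClosedAt e x
    guard = guardedReduction-isCharFn⁻ isChar′
    open BranchOfColumn (λ Y → bottom (f (+ 0) Y)) (λ Y → up (f (+ 0) Y)) (stacked (+ 0))
                (λ Y → proj₂ (proj₂ (columnTile⁻ (f (+ 0) Y) (f∈ (+ 0) Y))))

ILL≤TILE : ILL ≤m TILE
ILL≤TILE = columnReduction , reduction-computable _ , λ e → columnReduction-preserves e , columnReduction-reflects e

mainTheorem1 : (TILE ≤m ILL) × (ILL ≤m TILE)
mainTheorem1 = TILE≤ILL , ILL≤TILE
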